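{- Let $(P,\mathcal{B})$ be a pairwise balanced design with $n\geq 2$ points, and let $\tau$ be the maximum size of a block in $\mathcal{B}$. Then \[\sum_{B\in\mathcal{B}}|B|\geq \frac{n(n-1)}{\tau-1}.\] Moreover, if $\mathcal{B}$ contains a block of size $k$, then \[\sum_{B\in\mathcal{B}}|B|\geq (n+1)k-\frac{k^2(k-1)}{n-1}\qquad\text{and}\qquad \sum_{B\in\mathcal{B}}|B|\geq k-\frac{(n-k)(n-5k-1)}{2}.\] Furthermore, if $k\geq n/2$, then there exists a pairwise balanced design on $n$ points having a block of size $k$ for which $\sum_{B\in\mathcal{B}}|B|= k-\frac{(n-k)(n-5k-1)}{2}$.
   Context: A pairwise balanced design (PBD) is a pair $(P,\mathcal{B})$ where $P$ is a finite set of $n$ points and $\mathcal{B}$ is a family of subsets of $P$ (blocks) such that every two distinct points of $P$ lie in exactly one block. -}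

module Defs where

open import Data.Nat using (ℕ; _⊔_)
open import Data.Fin using (Fin)
open import Data.Fin.Subset using (Subset; _∈_; ∣_∣)
open import Data.Fin.Subset.Properties using (_∈?_)
open import Data.List using (List; filter; length; foldr; map)
open import Data.Nat.ListAction using (sum)
open import Data.List.Relation.Unary.Unique.Propositional using (Unique)
open import Data.Product using (_×_)
open import Relation.Nullary using (¬_)
open import Relation.Nullary.Decidable using (_×-dec_)
open import Relation.Binary.PropositionalEquality using (_≡_)

-- A family of blocks on the point set Fin n is a list of subsets,
-- required to be duplicate-free (so it is a genuine set of subsets).

blocksThrough : ∀ {n} → Fin n → Fin n → List (Subset n) → ℕ
blocksThrough x y 𝓑 = length (filter (λ B → (x ∈? B) ×-dec (y ∈? B)) 𝓑)

IsPBD : (n : ℕ) → List (Subset n) → Set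
IsPBD n 𝓑 = Unique 𝓑 × (∀ (x y : Fin n) → ¬ (x ≡ y) → blocksThrough x y 𝓑 ≡ 1)

-- maximum size of a block (0 for the empty family)
maxBlockSize : ∀ {n} → List (Subset n) → ℕ
maxBlockSize 𝓑 = foldr (λ B m → ∣ B ∣ ⊔ m) 0 𝓑

totalSize : ∀ {n} → List (Subset n) → ℕ
totalSize 𝓑 = sum (map ∣_∣ 𝓑)

-- Double counting incident pairs of points: for weights f, g on the points, with f(B) = Σ_{x ∈ B} f(x),
--   Σ_B f(B) g(B) + Σ_x f(x) g(x) = (Σ_x f(x)) (Σ_x g(x)) + Σ_B (f g)(B),
-- because two distinct points lie in exactly one block. For f = g = 1 this reads Σ|B|² + n = n² + Σ|B|,
-- and Σ|B|² ≤ τ Σ|B| gives the first bound. Taking for f, g the indicators of a block B₀ with |B₀| = k and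
-- of its complement, of size D = n - k, every other block B has a = |B ∩ B₀| ≤ 1 and o = |B ∖ B₀| with
-- Σ a o = k D and Σ o (o - 1) = D (D - 1). The other two bounds follow by summing inequalities that hold
-- for each block with a ≤ 1; for a = 1 one of them is (n - 1 - k o)² ≥ 0.
-- For n ≤ 2k the last bound is attained: with m = n - k points k + i outside B₀ = {0, …, k - 1}, take the
-- triples {(i + j) mod m, k + i, k + j} and, as blocks of size 2, the pairs {x, k + i} they leave uncovered.

module Submission where

open import Defs
open import Data.Nat using (ℕ; _≤_; _*_; _∸_; _+_)
open import Data.Integer using (ℤ; +_) renaming (_*_ to _*ℤ_; _-_ to _-ℤ_; _≤_ to _≤ℤ_)
open import Data.Fin.Subset using (Subset; ∣_∣)
open import Data.List using (List)
open import Data.List.Membership.Propositional using (_∈_)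
open import Data.Product using (_×_; Σ)
open import Relation.Binary.PropositionalEquality using (_≡_)

open import Data.Nat using (zero; suc; _<_; _<?_; _≤?_; z≤n; s≤s; s≤s⁻¹; >-nonZero)
open import Data.Nat.ListAction using (sum)
open import Data.Nat.ListAction.Properties using (sum-++)
open import Data.Nat.Properties
open import Algebra.Properties.CommutativeSemigroup +-commutativeSemigroup
  using () renaming (interchange to +-interchange; x∙yz≈y∙xz to x+yz≡y+xz)
open import Algebra.Properties.Semiring.Sum +-*-semiring
  using (sum-syntax; sum-cong-≗; ∑-distrib-+; *-distribˡ-sum; *-distribʳ-sum; sum-replicate-zero)
  renaming (sum to ∑)
open import Data.Nat.Tactic.RingSolver using (solve-∀)
open import Data.Bool using (Bool; true; false; _∧_; _∨_; not; if_then_else_)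
open import Data.Bool.Properties using (∧-comm)
open import Data.Empty using (⊥; ⊥-elim)
open import Data.Fin using (Fin; zero; suc; toℕ; fromℕ<) renaming (_≟_ to _≟ᶠ_)
open import Data.Fin.Properties using (toℕ-fromℕ<; fromℕ<-toℕ; toℕ<n; toℕ-injective)
open import Data.Fin.Subset using () renaming (_∈_ to _∈ₛ_)
open import Data.Fin.Subset.Properties using () renaming (_∈?_ to _∈ₛ?_)
open import Data.Integer using () renaming (_+_ to _+ℤ_)
import Data.Integer as ℤ
import Data.Integer.Properties as ℤ
open import Data.Integer.Tactic.RingSolver using () renaming (solve-∀ to ℤ-solve-∀)
open import Data.List using ([]; _∷_; _++_; map; filter; length; upTo)
open import Data.List.Membership.DecPropositional _≟_ using () renaming (_∈?_ to _∈ℕ?_)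
open import Data.List.Membership.Propositional.Properties
  using (∈-∃++; ∈-++⁻; ∈-++⁺ˡ; ∈-++⁺ʳ; ∈-map⁺; ∈-map⁻; ∈-upTo⁺; ∈-upTo⁻)
open import Data.List.Properties
  using (map-cong; map-cong-local; map-++; map-∘; length-++; length-map; length-upTo)
open import Data.List.Relation.Unary.All as All using (All; []; _∷_)
import Data.List.Relation.Unary.All.Properties as All
open import Data.List.Relation.Unary.AllPairs using ([]; _∷_)
open import Data.List.Relation.Unary.Any using (here; there)
open import Data.List.Relation.Unary.Unique.Propositional using (Unique)
import Data.List.Relation.Unary.Unique.Propositional.Properties as Unique
open import Data.Product using (_,_; proj₁; proj₂)
open import Data.Sum using (_⊎_; inj₁; inj₂)
import Data.Sum as Sum
open import Data.Vec using ([]; _∷_; tabulate)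
open import Data.Vec.Properties using (lookup∘tabulate; lookup⇒[]=; []=⇒lookup)
open import Function using (_∘_)
open import Function.Bundles using (_⇔_; mk⇔)
open import Relation.Binary.Definitions using (tri<; tri≈; tri>)
open import Relation.Binary.PropositionalEquality
  using (refl; sym; trans; cong; cong₂; subst; subst₂; _≢_; module ≡-Reasoning)
open import Relation.Nullary using (¬_; Dec; does; yes; no)
open import Relation.Nullary.Decidable using (dec-true; dec-false; does-⇔; _×-dec_; _⊎-dec_)
open import Relation.Unary using (Decidable)

𝟙 : Bool → ℕ
𝟙 true = 1
𝟙 false = 0

𝟙-∧ : ∀ a b → 𝟙 (a ∧ b) ≡ 𝟙 a * 𝟙 b
𝟙-∧ true b = sym (+-identityʳ (𝟙 b))
𝟙-∧ false b = refl

𝟙-idem : ∀ b → 𝟙 b * 𝟙 b ≡ 𝟙 b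
𝟙-idem true = refl
𝟙-idem false = refl

𝟙-∨ : ∀ a b → (a ≡ true → b ≡ false) → 𝟙 (a ∨ b) ≡ 𝟙 a + 𝟙 b
𝟙-∨ true b a⇒¬b rewrite a⇒¬b refl = refl
𝟙-∨ false b _ = refl

𝟙+𝟙-not : ∀ b → 𝟙 b + 𝟙 (not b) ≡ 1
𝟙+𝟙-not true = refl
𝟙+𝟙-not false = refl

𝟙*𝟙-not : ∀ b → 𝟙 b * 𝟙 (not b) ≡ 0
𝟙*𝟙-not true = refl
𝟙*𝟙-not false = refl

∑ᴸ : {A : Set} → List A → (A → ℕ) → ℕ
∑ᴸ xs f = sum (map f xs)

module _ {A : Set} where

  ∑ᴸ-cong : ∀ (xs : List A) {f g : A → ℕ} → (∀ x → f x ≡ g x) → ∑ᴸ xs f ≡ ∑ᴸ xs g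
  ∑ᴸ-cong xs f≗g = cong sum (map-cong f≗g xs)

  ∑ᴸ-++ : ∀ (xs ys : List A) f → ∑ᴸ (xs ++ ys) f ≡ ∑ᴸ xs f + ∑ᴸ ys f
  ∑ᴸ-++ xs ys f = trans (cong sum (map-++ f xs ys)) (sum-++ (map f xs) (map f ys))

  ∑ᴸ-const : ∀ (xs : List A) c → ∑ᴸ xs (λ _ → c) ≡ c * length xs
  ∑ᴸ-const [] c = sym (*-zeroʳ c)
  ∑ᴸ-const (x ∷ xs) c = trans (cong (λ t → c + t) (∑ᴸ-const xs c)) (sym (*-suc c (length xs)))

  ∑ᴸ-+ : ∀ (xs : List A) f g → ∑ᴸ xs (λ x → f x + g x) ≡ ∑ᴸ xs f + ∑ᴸ xs g
  ∑ᴸ-+ [] f g = refl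
  ∑ᴸ-+ (x ∷ xs) f g = begin
    (f x + g x) + ∑ᴸ xs (λ x → f x + g x) ≡⟨ cong (λ t → (f x + g x) + t) (∑ᴸ-+ xs f g) ⟩
    (f x + g x) + (∑ᴸ xs f + ∑ᴸ xs g)     ≡⟨ +-interchange (f x) (g x) _ _ ⟩
    (f x + ∑ᴸ xs f) + (g x + ∑ᴸ xs g)     ∎
    where open ≡-Reasoning

  ∑ᴸ-*ˡ : ∀ (xs : List A) c f → ∑ᴸ xs (λ x → c * f x) ≡ c * ∑ᴸ xs f
  ∑ᴸ-*ˡ [] c f = sym (*-zeroʳ c)
  ∑ᴸ-*ˡ (x ∷ xs) c f = trans (cong (λ t → c * f x + t) (∑ᴸ-*ˡ xs c f)) (sym (*-distribˡ-+ c (f x) _))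

  ∈⇒≤∑ᴸ : ∀ {x} {xs : List A} (f : A → ℕ) → x ∈ xs → f x ≤ ∑ᴸ xs f
  ∈⇒≤∑ᴸ f (here refl) = m≤m+n (f _) _
  ∈⇒≤∑ᴸ {xs = y ∷ _} f (there x∈xs) = ≤-trans (∈⇒≤∑ᴸ f x∈xs) (m≤n+m _ (f y))

  ∑ᴸ-mono-≤ : ∀ {xs : List A} {f g : A → ℕ} → All (λ x → f x ≤ g x) xs → ∑ᴸ xs f ≤ ∑ᴸ xs g
  ∑ᴸ-mono-≤ [] = z≤n
  ∑ᴸ-mono-≤ (f≤g ∷ fs≤gs) = +-mono-≤ f≤g (∑ᴸ-mono-≤ fs≤gs)

  ∑ᴸ≡∑ᴸ⇒All≡ : ∀ (xs : List A) {f g : A → ℕ} → (∀ x → f x ≤ g x) →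
                ∑ᴸ xs f ≡ ∑ᴸ xs g → All (λ x → f x ≡ g x) xs
  ∑ᴸ≡∑ᴸ⇒All≡ [] f≤g _ = []
  ∑ᴸ≡∑ᴸ⇒All≡ (x ∷ xs) {f} {g} f≤g ∑f≡∑g =
    fx≡gx ∷ ∑ᴸ≡∑ᴸ⇒All≡ xs f≤g (+-cancelˡ-≡ (f x) _ _ rest)
    where
    ∑f≤∑g : ∑ᴸ xs f ≤ ∑ᴸ xs g
    ∑f≤∑g = ∑ᴸ-mono-≤ {xs = xs} (All.tabulate (λ {y} _ → f≤g y))
    fx≡gx : f x ≡ g x
    fx≡gx = ≤-antisym (f≤g x) (+-cancelʳ-≤ (∑ᴸ xs g) _ _
              (subst (_≤ f x + ∑ᴸ xs g) ∑f≡∑g (+-monoʳ-≤ (f x) ∑f≤∑g)))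
    rest : f x + ∑ᴸ xs f ≡ f x + ∑ᴸ xs g
    rest = trans ∑f≡∑g (cong (_+ ∑ᴸ xs g) (sym fx≡gx))

  ∑ᴸ-extract : ∀ (xs ys : List A) x f → ∑ᴸ (xs ++ x ∷ ys) f ≡ f x + ∑ᴸ (xs ++ ys) f
  ∑ᴸ-extract xs ys x f = begin
    ∑ᴸ (xs ++ x ∷ ys) f           ≡⟨ ∑ᴸ-++ xs (x ∷ ys) f ⟩
    ∑ᴸ xs f + (f x + ∑ᴸ ys f)     ≡⟨ x+yz≡y+xz (∑ᴸ xs f) (f x) (∑ᴸ ys f) ⟩
    f x + (∑ᴸ xs f + ∑ᴸ ys f)     ≡⟨ cong (λ t → f x + t) (sym (∑ᴸ-++ xs ys f)) ⟩
    f x + ∑ᴸ (xs ++ ys) f         ∎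
    where open ≡-Reasoning

  ∑ᴸ-∑-comm : ∀ {n} (xs : List A) (F : A → Fin n → ℕ) →
              ∑ᴸ xs (λ x → ∑[ i < n ] F x i) ≡ ∑[ i < n ] ∑ᴸ xs (λ x → F x i)
  ∑ᴸ-∑-comm {n} [] F = sym (sum-replicate-zero n)
  ∑ᴸ-∑-comm {n} (x ∷ xs) F =
    trans (cong (λ t → ∑ (F x) + t) (∑ᴸ-∑-comm xs F)) (sym (∑-distrib-+ (F x) (λ i → ∑ᴸ xs (λ y → F y i))))

  length-filter≡∑ᴸ𝟙 : ∀ {P : A → Set} (P? : Decidable P) xs →
                      length (filter P? xs) ≡ ∑ᴸ xs (λ x → 𝟙 (does (P? x)))
  length-filter≡∑ᴸ𝟙 P? [] = refl
  length-filter≡∑ᴸ𝟙 P? (x ∷ xs) with does (P? x)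
  ... | true = cong suc (length-filter≡∑ᴸ𝟙 P? xs)
  ... | false = length-filter≡∑ᴸ𝟙 P? xs

  ∑ᴸ-cong-All : ∀ {xs : List A} {f g : A → ℕ} → All (λ x → f x ≡ g x) xs → ∑ᴸ xs f ≡ ∑ᴸ xs g
  ∑ᴸ-cong-All f≡g = cong sum (map-cong-local f≡g)

  ∑ᴸ-map : ∀ {B : Set} (h : B → A) (xs : List B) f → ∑ᴸ (map h xs) f ≡ ∑ᴸ xs (f ∘ h)
  ∑ᴸ-map h xs f = cong sum (sym (map-∘ xs))

  module _ {P : A → Set} (P? : Decidable P) where

    ∑ᴸ-𝟙-none : ∀ {xs} → (∀ {x} → x ∈ xs → ¬ P x) → ∑ᴸ xs (λ x → 𝟙 (does (P? x))) ≡ 0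
    ∑ᴸ-𝟙-none {[]} _ = refl
    ∑ᴸ-𝟙-none {x ∷ xs} ¬P = cong₂ _+_ (cong 𝟙 (dec-false (P? x) (¬P (here refl)))) (∑ᴸ-𝟙-none (¬P ∘ there))

    ∑ᴸ-𝟙-single : ∀ {xs x₀} → Unique xs → x₀ ∈ xs → P x₀ →
                  (∀ {x} → x ∈ xs → P x → x ≡ x₀) → ∑ᴸ xs (λ x → 𝟙 (does (P? x))) ≡ 1
    ∑ᴸ-𝟙-single {x ∷ xs} (x∉xs ∷ _) (here refl) Px₀ only =
      cong₂ _+_ (cong 𝟙 (dec-true (P? x) Px₀))
                (∑ᴸ-𝟙-none (λ y∈xs Py → All.lookup x∉xs y∈xs (sym (only (there y∈xs) Py))))
    ∑ᴸ-𝟙-single {x ∷ xs} (x∉xs ∷ unique) (there x₀∈xs) Px₀ only =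
      cong₂ _+_ (cong 𝟙 (dec-false (P? x) (λ Px → All.lookup x∉xs x₀∈xs (only (here refl) Px))))
                (∑ᴸ-𝟙-single unique x₀∈xs Px₀ (λ x∈xs → only (there x∈xs)))

-- Counting pairs of points in a pairwise balanced design

χ : ∀ {n} → Subset n → Fin n → ℕ
χ B x = 𝟙 (does (x ∈ₛ? B))

∣B∣≡∑χ : ∀ {n} (B : Subset n) → ∣ B ∣ ≡ ∑[ x < n ] χ B x
∣B∣≡∑χ [] = refl
∣B∣≡∑χ (true ∷ B) = cong suc (∣B∣≡∑χ B)
∣B∣≡∑χ (false ∷ B) = ∣B∣≡∑χ B

blocksThrough≡∑χχ : ∀ {n} (x y : Fin n) (𝓑 : List (Subset n)) →
                    blocksThrough x y 𝓑 ≡ ∑ᴸ 𝓑 (λ B → χ B x * χ B y)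
blocksThrough≡∑χχ x y 𝓑 =
  trans (length-filter≡∑ᴸ𝟙 _ 𝓑) (∑ᴸ-cong 𝓑 (λ B → 𝟙-∧ (does (x ∈ₛ? B)) (does (y ∈ₛ? B))))

δ : ∀ {n} → Fin n → Fin n → ℕ
δ x y = 𝟙 (does (x ≟ᶠ y))

∑-δ : ∀ {n} (h : Fin n → ℕ) (x : Fin n) → ∑[ y < n ] (h y * δ x y) ≡ h x
∑-δ {suc n} h zero = begin
  h zero * 1 + ∑[ y < n ] (h (suc y) * 0)
    ≡⟨ cong₂ _+_ (*-identityʳ (h zero)) (sum-cong-≗ {n} (λ y → *-zeroʳ (h (suc y)))) ⟩
  h zero + ∑[ y < n ] 0    ≡⟨ cong (λ t → h zero + t) (sum-replicate-zero n) ⟩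
  h zero + 0               ≡⟨ +-identityʳ (h zero) ⟩
  h zero                   ∎
  where open ≡-Reasoning
∑-δ {suc n} h (suc x) = cong₂ _+_ (*-zeroʳ (h zero)) (∑-δ (h ∘ suc) x)

weight : ∀ {n} → Subset n → (Fin n → ℕ) → ℕ
weight {n} B f = ∑[ x < n ] (χ B x * f x)

module PairCount {n} {𝓑 : List (Subset n)} (pbd : IsPBD n 𝓑) where

  λ𝓑 : Fin n → Fin n → ℕ
  λ𝓑 x y = ∑ᴸ 𝓑 (λ B → χ B x * χ B y)

  λ𝓑-≢ : ∀ {x y} → x ≢ y → λ𝓑 x y ≡ 1
  λ𝓑-≢ {x} {y} x≢y = trans (sym (blocksThrough≡∑χχ x y 𝓑)) (proj₂ pbd x y x≢y)

  ∑ᴸ-weight*weight : ∀ f g →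
    ∑ᴸ 𝓑 (λ B → weight B f * weight B g) ≡ ∑[ x < n ] ∑[ y < n ] (f x * g y * λ𝓑 x y)
  ∑ᴸ-weight*weight f g = begin
    ∑ᴸ 𝓑 (λ B → weight B f * weight B g)
      ≡⟨ ∑ᴸ-cong 𝓑 (λ B → *-distribʳ-sum (weight B g) (λ x → χ B x * f x)) ⟩
    ∑ᴸ 𝓑 (λ B → ∑[ x < n ] (χ B x * f x * weight B g))
      ≡⟨ ∑ᴸ-∑-comm 𝓑 (λ B x → χ B x * f x * weight B g) ⟩
    ∑[ x < n ] ∑ᴸ 𝓑 (λ B → χ B x * f x * weight B g)
      ≡⟨ sum-cong-≗ {n} (λ x → ∑ᴸ-cong 𝓑 (λ B → *-distribˡ-sum (χ B x * f x) (λ y → χ B y * g y))) ⟩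
    ∑[ x < n ] ∑ᴸ 𝓑 (λ B → ∑[ y < n ] (χ B x * f x * (χ B y * g y)))
      ≡⟨ sum-cong-≗ {n} (λ x → ∑ᴸ-∑-comm 𝓑 (λ B y → χ B x * f x * (χ B y * g y))) ⟩
    ∑[ x < n ] ∑[ y < n ] ∑ᴸ 𝓑 (λ B → χ B x * f x * (χ B y * g y))
      ≡⟨ sum-cong-≗ {n} (λ x → sum-cong-≗ {n} (λ y →
           trans (∑ᴸ-cong 𝓑 (λ B → regroup (χ B x) (f x) (χ B y) (g y)))
                 (∑ᴸ-*ˡ 𝓑 (f x * g y) (λ B → χ B x * χ B y)))) ⟩
    ∑[ x < n ] ∑[ y < n ] (f x * g y * λ𝓑 x y) ∎
    where
    open ≡-Reasoning
    regroup : ∀ a b c d → a * b * (c * d) ≡ b * d * (a * c)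
    regroup = solve-∀

  ∑ᴸ-weight : ∀ h → ∑ᴸ 𝓑 (λ B → weight B h) ≡ ∑[ x < n ] (h x * λ𝓑 x x)
  ∑ᴸ-weight h = trans (∑ᴸ-∑-comm 𝓑 (λ B x → χ B x * h x)) (sum-cong-≗ {n} (λ x →
    trans (∑ᴸ-cong 𝓑 (λ B → trans (*-comm (χ B x) (h x)) (cong (h x *_) (sym (𝟙-idem (does (x ∈ₛ? B)))))))
          (∑ᴸ-*ˡ 𝓑 (h x) (λ B → χ B x * χ B x))))

  -- Off the diagonal λ𝓑 x y = 1; the δ terms separate the diagonal without truncated subtraction.
  λ𝓑-diagonal : ∀ c x y → c * λ𝓑 x y + c * δ x y ≡ c + c * λ𝓑 x x * δ x y
  λ𝓑-diagonal c x y with x ≟ᶠ y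
  ... | yes refl = on-diagonal c (λ𝓑 x x)
    where
    on-diagonal : ∀ c l → c * l + c * 1 ≡ c + c * l * 1
    on-diagonal = solve-∀
  ... | no x≢y rewrite λ𝓑-≢ x≢y = off-diagonal c (λ𝓑 x x)
    where
    off-diagonal : ∀ c l → c * 1 + c * 0 ≡ c + c * l * 0
    off-diagonal = solve-∀

  row-sum : ∀ (f g : Fin n → ℕ) x →
    ∑[ y < n ] (f x * g y * λ𝓑 x y) + f x * g x ≡ ∑[ y < n ] (f x * g y) + f x * g x * λ𝓑 x x
  row-sum f g x = begin
    ∑[ y < n ] (f x * g y * λ𝓑 x y) + f x * g x
      ≡⟨ cong (λ t → ∑[ y < n ] (f x * g y * λ𝓑 x y) + t) (sym (∑-δ (λ y → f x * g y) x)) ⟩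
    ∑[ y < n ] (f x * g y * λ𝓑 x y) + ∑[ y < n ] (f x * g y * δ x y)
      ≡⟨ sym (∑-distrib-+ (λ y → f x * g y * λ𝓑 x y) _) ⟩
    ∑[ y < n ] (f x * g y * λ𝓑 x y + f x * g y * δ x y)
      ≡⟨ sum-cong-≗ {n} (λ y → λ𝓑-diagonal (f x * g y) x y) ⟩
    ∑[ y < n ] (f x * g y + f x * g y * λ𝓑 x x * δ x y)
      ≡⟨ ∑-distrib-+ (λ y → f x * g y) _ ⟩
    ∑[ y < n ] (f x * g y) + ∑[ y < n ] (f x * g y * λ𝓑 x x * δ x y)
      ≡⟨ cong (λ t → ∑[ y < n ] (f x * g y) + t) (∑-δ (λ y → f x * g y * λ𝓑 x x) x) ⟩
    ∑[ y < n ] (f x * g y) + f x * g x * λ𝓑 x x ∎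
    where open ≡-Reasoning

  pair-count : ∀ f g →
    ∑ᴸ 𝓑 (λ B → weight B f * weight B g) + ∑[ x < n ] (f x * g x)
      ≡ (∑[ x < n ] f x) * (∑[ y < n ] g y) + ∑ᴸ 𝓑 (λ B → weight B (λ x → f x * g x))
  pair-count f g = begin
    ∑ᴸ 𝓑 (λ B → weight B f * weight B g) + ∑[ x < n ] (f x * g x)
      ≡⟨ cong (_+ ∑[ x < n ] (f x * g x)) (∑ᴸ-weight*weight f g) ⟩
    ∑[ x < n ] ∑[ y < n ] (f x * g y * λ𝓑 x y) + ∑[ x < n ] (f x * g x)
      ≡⟨ sym (∑-distrib-+ (λ x → ∑[ y < n ] (f x * g y * λ𝓑 x y)) _) ⟩
    ∑[ x < n ] (∑[ y < n ] (f x * g y * λ𝓑 x y) + f x * g x)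
      ≡⟨ sum-cong-≗ {n} (row-sum f g) ⟩
    ∑[ x < n ] (∑[ y < n ] (f x * g y) + f x * g x * λ𝓑 x x)
      ≡⟨ ∑-distrib-+ (λ x → ∑[ y < n ] (f x * g y)) _ ⟩
    ∑[ x < n ] ∑[ y < n ] (f x * g y) + ∑[ x < n ] (f x * g x * λ𝓑 x x)
      ≡⟨ cong₂ _+_ (trans (sum-cong-≗ {n} (λ x → sym (*-distribˡ-sum (f x) g))) (sym (*-distribʳ-sum (∑ g) f)))
                   (sym (∑ᴸ-weight (λ x → f x * g x))) ⟩
    (∑[ x < n ] f x) * (∑[ y < n ] g y) + ∑ᴸ 𝓑 (λ B → weight B (λ x → f x * g x)) ∎
    where open ≡-Reasoning

-- The bound n (n - 1) ≤ (τ - 1) Σ|B|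

∑-const-1 : ∀ n → ∑[ x < n ] 1 ≡ n
∑-const-1 zero = refl
∑-const-1 (suc n) = cong suc (∑-const-1 n)

weight-1 : ∀ {n} (B : Subset n) → weight B (λ _ → 1) ≡ ∣ B ∣
weight-1 {n} B = trans (sum-cong-≗ {n} (λ x → *-identityʳ (χ B x))) (sym (∣B∣≡∑χ B))

size≤maxBlockSize : ∀ {n} (𝓑 : List (Subset n)) → All (λ B → ∣ B ∣ ≤ maxBlockSize 𝓑) 𝓑
size≤maxBlockSize [] = []
size≤maxBlockSize (B ∷ 𝓑) =
  m≤m⊔n ∣ B ∣ _ ∷ All.map (λ ≤max → ≤-trans ≤max (m≤n⊔m ∣ B ∣ _)) (size≤maxBlockSize 𝓑)

∑ᴸ-size² : ∀ {n} {𝓑 : List (Subset n)} → IsPBD n 𝓑 →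
           ∑ᴸ 𝓑 (λ B → ∣ B ∣ * ∣ B ∣) + n ≡ n * n + totalSize 𝓑
∑ᴸ-size² {n} {𝓑} pbd = begin
  ∑ᴸ 𝓑 (λ B → ∣ B ∣ * ∣ B ∣) + n
    ≡⟨ cong₂ _+_ (∑ᴸ-cong 𝓑 (λ B → sym (cong₂ _*_ (weight-1 B) (weight-1 B)))) (sym (∑-const-1 n)) ⟩
  ∑ᴸ 𝓑 (λ B → weight B (λ _ → 1) * weight B (λ _ → 1)) + ∑[ x < n ] 1
    ≡⟨ pair-count (λ _ → 1) (λ _ → 1) ⟩
  (∑[ x < n ] 1) * (∑[ x < n ] 1) + ∑ᴸ 𝓑 (λ B → weight B (λ _ → 1))
    ≡⟨ cong₂ _+_ (cong₂ _*_ (∑-const-1 n) (∑-const-1 n)) (∑ᴸ-cong 𝓑 weight-1) ⟩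
  n * n + totalSize 𝓑 ∎
  where
  open ≡-Reasoning
  open PairCount pbd

n*m≤[n∸1]*m+m : ∀ τ T → τ * T ≤ (τ ∸ 1) * T + T
n*m≤[n∸1]*m+m zero T = z≤n
n*m≤[n∸1]*m+m (suc τ) T = ≤-reflexive (+-comm T (τ * T))

fisher-arithmetic : ∀ n τ T → n * n + T ≤ τ * T + n → n * (n ∸ 1) ≤ (τ ∸ 1) * T
fisher-arithmetic zero τ T _ = z≤n
fisher-arithmetic n@(suc n-1) τ T n²+T≤τT+n = +-cancelʳ-≤ (n + T) _ _ (begin
  n * n-1 + (n + T)     ≡⟨ square-split n-1 T ⟩
  n * n + T             ≤⟨ n²+T≤τT+n ⟩
  τ * T + n             ≤⟨ +-monoˡ-≤ n (n*m≤[n∸1]*m+m τ T) ⟩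
  (τ ∸ 1) * T + T + n   ≡⟨ +-assoc ((τ ∸ 1) * T) T n ⟩
  (τ ∸ 1) * T + (T + n) ≡⟨ cong (λ t → (τ ∸ 1) * T + t) (+-comm T n) ⟩
  (τ ∸ 1) * T + (n + T) ∎)
  where
  open ≤-Reasoning
  square-split : ∀ a T → suc a * a + (suc a + T) ≡ suc a * suc a + T
  square-split = solve-∀

fisherBound : ∀ {n} {𝓑 : List (Subset n)} → IsPBD n 𝓑 →
              n * (n ∸ 1) ≤ (maxBlockSize 𝓑 ∸ 1) * totalSize 𝓑
fisherBound {n} {𝓑} pbd = fisher-arithmetic n (maxBlockSize 𝓑) (totalSize 𝓑) (begin
  n * n + totalSize 𝓑
    ≡⟨ sym (∑ᴸ-size² pbd) ⟩
  ∑ᴸ 𝓑 (λ B → ∣ B ∣ * ∣ B ∣) + n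
    ≤⟨ +-monoˡ-≤ n (∑ᴸ-mono-≤ (All.map (*-monoˡ-≤ _) (size≤maxBlockSize 𝓑))) ⟩
  ∑ᴸ 𝓑 (λ B → maxBlockSize 𝓑 * ∣ B ∣) + n
    ≡⟨ cong (_+ n) (∑ᴸ-*ˡ 𝓑 (maxBlockSize 𝓑) ∣_∣) ⟩
  maxBlockSize 𝓑 * totalSize 𝓑 + n ∎)
  where open ≤-Reasoning

-- The bounds in terms of a block B₀ of size k

n≤n*n : ∀ n → n ≤ n * n
n≤n*n zero = z≤n
n≤n*n n@(suc _) = m≤m*n n n

n*n≡n⇒n≤1 : ∀ n → n * n ≡ n → n ≤ 1
n*n≡n⇒n≤1 zero _ = z≤n
n*n≡n⇒n≤1 (suc n) sq≡ = ≤-reflexive (*-cancelˡ-≡ (suc n) 1 (suc n) (trans sq≡ (sym (*-identityʳ (suc n)))))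

module AroundBlock {n} (xs : List (Subset n)) (B₀ : Subset n) (ys : List (Subset n))
                   (pbd : IsPBD n (xs ++ B₀ ∷ ys)) where

  open PairCount pbd

  𝓑 rest : List (Subset n)
  𝓑 = xs ++ B₀ ∷ ys
  rest = xs ++ ys

  in₀ out₀ : Fin n → ℕ
  in₀ x = 𝟙 (does (x ∈ₛ? B₀))
  out₀ x = 𝟙 (not (does (x ∈ₛ? B₀)))

  k D : ℕ
  k = ∣ B₀ ∣
  D = ∑[ x < n ] out₀ x

  meet away : Subset n → ℕ
  meet B = weight B in₀
  away B = weight B out₀

  weight-cong : ∀ B {f g : Fin n → ℕ} → (∀ x → f x ≡ g x) → weight B f ≡ weight B g
  weight-cong B f≗g = sum-cong-≗ {n} (λ x → cong (χ B x *_) (f≗g x))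

  weight-0 : ∀ B → weight B (λ _ → 0) ≡ 0
  weight-0 B = trans (sum-cong-≗ {n} (λ x → *-zeroʳ (χ B x))) (sum-replicate-zero n)

  ∑in₀ : ∑[ x < n ] in₀ x ≡ k
  ∑in₀ = sym (∣B∣≡∑χ B₀)

  k+D≡n : k + D ≡ n
  k+D≡n = begin
    k + D                          ≡⟨ cong (_+ D) (sym ∑in₀) ⟩
    ∑[ x < n ] in₀ x + D           ≡⟨ sym (∑-distrib-+ in₀ out₀) ⟩
    ∑[ x < n ] (in₀ x + out₀ x)    ≡⟨ sum-cong-≗ {n} (λ x → 𝟙+𝟙-not (does (x ∈ₛ? B₀))) ⟩
    ∑[ x < n ] 1                   ≡⟨ ∑-const-1 n ⟩
    n                              ∎
    where open ≡-Reasoning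

  size≡meet+away : ∀ B → ∣ B ∣ ≡ meet B + away B
  size≡meet+away B = begin
    ∣ B ∣                                    ≡⟨ ∣B∣≡∑χ B ⟩
    ∑[ x < n ] χ B x                         ≡⟨ sum-cong-≗ {n} split ⟩
    ∑[ x < n ] (χ B x * in₀ x + χ B x * out₀ x) ≡⟨ ∑-distrib-+ (λ x → χ B x * in₀ x) _ ⟩
    meet B + away B                          ∎
    where
    open ≡-Reasoning
    split : ∀ x → χ B x ≡ χ B x * in₀ x + χ B x * out₀ x
    split x = trans (sym (*-identityʳ (χ B x)))
                (trans (cong (χ B x *_) (sym (𝟙+𝟙-not (does (x ∈ₛ? B₀))))) (*-distribˡ-+ (χ B x) _ _))

  meet-B₀ : meet B₀ ≡ k
  meet-B₀ = trans (sum-cong-≗ {n} (λ x → 𝟙-idem (does (x ∈ₛ? B₀)))) ∑in₀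

  away-B₀ : away B₀ ≡ 0
  away-B₀ = trans (sum-cong-≗ {n} (λ x → 𝟙*𝟙-not (does (x ∈ₛ? B₀)))) (sum-replicate-zero n)

  ∑ᴸ-around : ∀ f → ∑ᴸ 𝓑 f ≡ f B₀ + ∑ᴸ rest f
  ∑ᴸ-around = ∑ᴸ-extract xs ys B₀

  ∑ᴸ-meet² : ∑ᴸ rest (λ B → meet B * meet B) ≡ ∑ᴸ rest meet
  ∑ᴸ-meet² = +-cancelˡ-≡ (k * k + k) _ _ (begin
    k * k + k + ∑ᴸ rest (λ B → meet B * meet B)
      ≡⟨ shuffle (k * k) k _ ⟩
    (k * k + ∑ᴸ rest (λ B → meet B * meet B)) + k
      ≡⟨ cong₂ (λ s t → (s * s + ∑ᴸ rest (λ B → meet B * meet B)) + t) (sym meet-B₀) (sym ∑in₀) ⟩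
    (meet B₀ * meet B₀ + ∑ᴸ rest (λ B → meet B * meet B)) + ∑[ x < n ] in₀ x
      ≡⟨ cong₂ _+_ (sym (∑ᴸ-around (λ B → meet B * meet B)))
                   (sum-cong-≗ {n} (λ x → sym (𝟙-idem (does (x ∈ₛ? B₀))))) ⟩
    ∑ᴸ 𝓑 (λ B → meet B * meet B) + ∑[ x < n ] (in₀ x * in₀ x)
      ≡⟨ pair-count in₀ in₀ ⟩
    (∑[ x < n ] in₀ x) * (∑[ x < n ] in₀ x) + ∑ᴸ 𝓑 (λ B → weight B (λ x → in₀ x * in₀ x))
      ≡⟨ cong₂ _+_ (cong₂ _*_ ∑in₀ ∑in₀)
                   (∑ᴸ-cong 𝓑 (λ B → weight-cong B (λ x → 𝟙-idem (does (x ∈ₛ? B₀))))) ⟩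
    k * k + ∑ᴸ 𝓑 meet
      ≡⟨ cong (λ t → k * k + t) (trans (∑ᴸ-around meet) (cong (_+ ∑ᴸ rest meet) meet-B₀)) ⟩
    k * k + (k + ∑ᴸ rest meet)
      ≡⟨ sym (+-assoc (k * k) k _) ⟩
    k * k + k + ∑ᴸ rest meet ∎)
    where
    open ≡-Reasoning
    shuffle : ∀ a b c → a + b + c ≡ (a + c) + b
    shuffle = solve-∀

  ∑ᴸ-meet*away : ∑ᴸ rest (λ B → meet B * away B) ≡ k * D
  ∑ᴸ-meet*away = begin
    ∑ᴸ rest (λ B → meet B * away B)
      ≡⟨ cong (_+ ∑ᴸ rest (λ B → meet B * away B))
              (sym (trans (cong (meet B₀ *_) away-B₀) (*-zeroʳ (meet B₀)))) ⟩
    meet B₀ * away B₀ + ∑ᴸ rest (λ B → meet B * away B)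
      ≡⟨ sym (∑ᴸ-around (λ B → meet B * away B)) ⟩
    ∑ᴸ 𝓑 (λ B → meet B * away B)
      ≡⟨ sym (+-identityʳ _) ⟩
    ∑ᴸ 𝓑 (λ B → meet B * away B) + 0
      ≡⟨ cong (λ t → ∑ᴸ 𝓑 (λ B → meet B * away B) + t)
              (sym (trans (sum-cong-≗ {n} (λ x → 𝟙*𝟙-not (does (x ∈ₛ? B₀)))) (sum-replicate-zero n))) ⟩
    ∑ᴸ 𝓑 (λ B → meet B * away B) + ∑[ x < n ] (in₀ x * out₀ x)
      ≡⟨ pair-count in₀ out₀ ⟩
    (∑[ x < n ] in₀ x) * D + ∑ᴸ 𝓑 (λ B → weight B (λ x → in₀ x * out₀ x))
      ≡⟨ cong₂ _+_ (cong (_* D) ∑in₀) (∑ᴸ-cong 𝓑 no-weight) ⟩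
    k * D + ∑ᴸ 𝓑 (λ _ → 0)
      ≡⟨ cong (λ t → k * D + t) (∑ᴸ-const 𝓑 0) ⟩
    k * D + 0
      ≡⟨ +-identityʳ (k * D) ⟩
    k * D ∎
    where
    open ≡-Reasoning
    no-weight : ∀ B → weight B (λ x → in₀ x * out₀ x) ≡ 0
    no-weight B = trans (weight-cong B (λ x → 𝟙*𝟙-not (does (x ∈ₛ? B₀)))) (weight-0 B)

  ∑ᴸ-away² : ∑ᴸ rest (λ B → away B * away B) + D ≡ D * D + ∑ᴸ rest away
  ∑ᴸ-away² = begin
    ∑ᴸ rest (λ B → away B * away B) + D
      ≡⟨ cong₂ _+_ (sym (trans (∑ᴸ-around (λ B → away B * away B))
                               (cong (λ t → t * t + ∑ᴸ rest (λ B → away B * away B)) away-B₀)))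
                   (sum-cong-≗ {n} (λ x → sym (𝟙-idem (not (does (x ∈ₛ? B₀)))))) ⟩
    ∑ᴸ 𝓑 (λ B → away B * away B) + ∑[ x < n ] (out₀ x * out₀ x)
      ≡⟨ pair-count out₀ out₀ ⟩
    D * D + ∑ᴸ 𝓑 (λ B → weight B (λ x → out₀ x * out₀ x))
      ≡⟨ cong (λ t → D * D + t)
              (∑ᴸ-cong 𝓑 (λ B → weight-cong B (λ x → 𝟙-idem (not (does (x ∈ₛ? B₀)))))) ⟩
    D * D + ∑ᴸ 𝓑 away
      ≡⟨ cong (λ t → D * D + t) (trans (∑ᴸ-around away) (cong (_+ ∑ᴸ rest away) away-B₀)) ⟩
    D * D + ∑ᴸ rest away ∎
    where open ≡-Reasoning

  meet≤1 : All (λ B → meet B ≤ 1) rest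
  meet≤1 = All.map (λ {B} sq≡ → n*n≡n⇒n≤1 (meet B) (sym sq≡))
                   (∑ᴸ≡∑ᴸ⇒All≡ rest (λ B → n≤n*n (meet B)) (sym ∑ᴸ-meet²))

  totalSize≡ : totalSize 𝓑 ≡ k + ∑ᴸ rest (λ B → meet B + away B)
  totalSize≡ = trans (∑ᴸ-around ∣_∣) (cong (λ t → k + t) (∑ᴸ-cong rest size≡meet+away))

≤-via-slack : ∀ {x y} e → y ≡ x + e → x ≤ y
≤-via-slack {x} e y≡x+e = subst (x ≤_) (sym y≡x+e) (m≤m+n x e)

2xy≤x²+y² : ∀ x y → 2 * x * y ≤ x * x + y * y
2xy≤x²+y² x y with ≤-total x y
... | inj₁ x≤y with m≤n⇒∃[o]m+o≡n x≤y
...   | d , refl = ≤-via-slack (d * d) (square-of-difference x d)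
  where
  square-of-difference : ∀ x d → x * x + (x + d) * (x + d) ≡ 2 * x * (x + d) + d * d
  square-of-difference = solve-∀
2xy≤x²+y² x y | inj₂ y≤x with m≤n⇒∃[o]m+o≡n y≤x
...   | d , refl = ≤-via-slack (d * d) (square-of-difference y d)
  where
  square-of-difference : ∀ y d → (y + d) * (y + d) + y * y ≡ 2 * (y + d) * y + d * d
  square-of-difference = solve-∀

pointwise-bound₂ : ∀ a o → a ≤ 1 → 4 * (a * o) + o ≤ 2 * (a + o) + o * o
pointwise-bound₂ zero o _ = ≤-via-slack (o + o * o) (slack o)
  where
  slack : ∀ o → 2 * (0 + o) + o * o ≡ (4 * (0 * o) + o) + (o + o * o)
  slack = solve-∀
pointwise-bound₂ (suc zero) zero _ = z≤n
pointwise-bound₂ (suc zero) (suc zero) _ = ≤-refl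
pointwise-bound₂ (suc zero) (suc (suc zero)) _ = ≤-refl
pointwise-bound₂ (suc zero) (suc (suc (suc p))) _ = ≤-via-slack (2 + 3 * p + p * p) (slack p)
  where
  slack : ∀ p → 2 * (1 + (3 + p)) + (3 + p) * (3 + p) ≡ (4 * (1 * (3 + p)) + (3 + p)) + (2 + 3 * p + p * p)
  slack = solve-∀
pointwise-bound₂ (suc (suc _)) _ (s≤s ())

-- For a = 1 the slack is (N - k·o)², hence the AM-GM step.
pointwise-bound₁ : ∀ N k a o → a ≤ 1 →
  N * N * (a * o) + 2 * k * N * (a * o) + k * k * o ≤ N * N * (a + o) + k * k * (o * o) + k * k * (a * o)
pointwise-bound₁ N k zero zero _ = ≤-via-slack 0 (slack N k)
  where
  slack : ∀ N k → N * N * (0 + 0) + k * k * (0 * 0) + k * k * (0 * 0)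
                  ≡ (N * N * (0 * 0) + 2 * k * N * (0 * 0) + k * k * 0) + 0
  slack = solve-∀
pointwise-bound₁ N k zero (suc p) _ = ≤-via-slack (N * N * suc p + k * k * (p * suc p)) (slack N k p)
  where
  slack : ∀ N k p → N * N * (0 + suc p) + k * k * (suc p * suc p) + k * k * (0 * suc p)
                    ≡ (N * N * (0 * suc p) + 2 * k * N * (0 * suc p) + k * k * suc p)
                      + (N * N * suc p + k * k * (p * suc p))
  slack = solve-∀
pointwise-bound₁ N k (suc zero) o _ with m≤n⇒∃[o]m+o≡n (2xy≤x²+y² N (k * o))
... | e , 2Nko+e≡N²+k²o² = ≤-via-slack e (begin
  N * N * (1 + o) + k * k * (o * o) + k * k * (1 * o)
    ≡⟨ expand N k o ⟩
  (N * N + (k * o) * (k * o)) + (N * N * o + k * k * o)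
    ≡⟨ cong (_+ (N * N * o + k * k * o)) (sym 2Nko+e≡N²+k²o²) ⟩
  (2 * N * (k * o) + e) + (N * N * o + k * k * o)
    ≡⟨ collect N k o e ⟩
  (N * N * (1 * o) + 2 * k * N * (1 * o) + k * k * o) + e ∎)
  where
  open ≡-Reasoning
  expand : ∀ N k o → N * N * (1 + o) + k * k * (o * o) + k * k * (1 * o)
                     ≡ (N * N + (k * o) * (k * o)) + (N * N * o + k * k * o)
  expand = solve-∀
  collect : ∀ N k o e → (2 * N * (k * o) + e) + (N * N * o + k * k * o)
                        ≡ (N * N * (1 * o) + 2 * k * N * (1 * o) + k * k * o) + e
  collect = solve-∀
pointwise-bound₁ N k (suc (suc _)) o (s≤s ())

-- Applied to the blocks B ≠ B₀ with a B = |B ∩ B₀|, o B = |B ∖ B₀|, k = |B₀| and D = n - k.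
module RestBounds {A : Set} (R : List A) (a o : A → ℕ) (a≤1 : All (λ B → a B ≤ 1) R) (k D : ℕ)
                  (∑ao : ∑ᴸ R (λ B → a B * o B) ≡ k * D)
                  (∑oo : ∑ᴸ R (λ B → o B * o B) + D ≡ D * D + ∑ᴸ R o) where

  S O OO : ℕ
  S = ∑ᴸ R (λ B → a B + o B)
  O = ∑ᴸ R o
  OO = ∑ᴸ R (λ B → o B * o B)

  ∑ᴸ-linear : ∀ c (f g : A → ℕ) → ∑ᴸ R (λ B → c * f B + g B) ≡ c * ∑ᴸ R f + ∑ᴸ R g
  ∑ᴸ-linear c f g = trans (∑ᴸ-+ R (λ B → c * f B) g) (cong (_+ ∑ᴸ R g) (∑ᴸ-*ˡ R c f))

  4kD+D≤2S+D² : 4 * (k * D) + D ≤ 2 * S + D * D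
  4kD+D≤2S+D² = +-cancelʳ-≤ O _ _ (begin
    4 * (k * D) + D + O   ≡⟨ +-comm-middle (4 * (k * D)) D O ⟩
    4 * (k * D) + O + D   ≡⟨ cong (λ t → 4 * t + O + D) (sym ∑ao) ⟩
    4 * ∑ᴸ R (λ B → a B * o B) + O + D
      ≡⟨ cong (_+ D) (sym (∑ᴸ-linear 4 (λ B → a B * o B) o)) ⟩
    ∑ᴸ R (λ B → 4 * (a B * o B) + o B) + D
      ≤⟨ +-monoˡ-≤ D (∑ᴸ-mono-≤ (All.map (λ {B} → pointwise-bound₂ (a B) (o B)) a≤1)) ⟩
    ∑ᴸ R (λ B → 2 * (a B + o B) + o B * o B) + D
      ≡⟨ cong (_+ D) (∑ᴸ-linear 2 (λ B → a B + o B) (λ B → o B * o B)) ⟩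
    2 * S + OO + D        ≡⟨ +-assoc (2 * S) OO D ⟩
    2 * S + (OO + D)      ≡⟨ cong (λ t → 2 * S + t) ∑oo ⟩
    2 * S + (D * D + O)   ≡⟨ sym (+-assoc (2 * S) (D * D) O) ⟩
    2 * S + D * D + O     ∎)
    where
    open ≤-Reasoning
    +-comm-middle : ∀ x y z → x + y + z ≡ x + z + y
    +-comm-middle = solve-∀

  ∑ᴸ-linear₃ : ∀ X Y Z (f g h : A → ℕ) →
    ∑ᴸ R (λ B → X * f B + Y * g B + Z * h B) ≡ X * ∑ᴸ R f + Y * ∑ᴸ R g + Z * ∑ᴸ R h
  ∑ᴸ-linear₃ X Y Z f g h = trans (∑ᴸ-+ R (λ B → X * f B + Y * g B) (λ B → Z * h B))
    (cong₂ _+_ (trans (∑ᴸ-linear X f (λ B → Y * g B)) (cong (λ t → X * ∑ᴸ R f + t) (∑ᴸ-*ˡ R Y g)))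
               (∑ᴸ-*ˡ R Z h))

  summed-bound₁ : ∀ N → N * N * (k * D) + 2 * k * N * (k * D) + k * k * O ≤ N * N * S + k * k * OO + k * k * (k * D)
  summed-bound₁ N = begin
    N * N * (k * D) + 2 * k * N * (k * D) + k * k * O
      ≡⟨ cong (λ t → N * N * t + 2 * k * N * t + k * k * O) (sym ∑ao) ⟩
    N * N * ∑ᴸ R (λ B → a B * o B) + 2 * k * N * ∑ᴸ R (λ B → a B * o B) + k * k * O
      ≡⟨ sym (∑ᴸ-linear₃ (N * N) (2 * k * N) (k * k) (λ B → a B * o B) (λ B → a B * o B) o) ⟩
    ∑ᴸ R (λ B → N * N * (a B * o B) + 2 * k * N * (a B * o B) + k * k * o B)
      ≤⟨ ∑ᴸ-mono-≤ (All.map (λ {B} → pointwise-bound₁ N k (a B) (o B)) a≤1) ⟩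
    ∑ᴸ R (λ B → N * N * (a B + o B) + k * k * (o B * o B) + k * k * (a B * o B))
      ≡⟨ ∑ᴸ-linear₃ (N * N) (k * k) (k * k) (λ B → a B + o B) (λ B → o B * o B) (λ B → a B * o B) ⟩
    N * N * S + k * k * OO + k * k * ∑ᴸ R (λ B → a B * o B)
      ≡⟨ cong (λ t → N * N * S + k * k * OO + k * k * t) ∑ao ⟩
    N * N * S + k * k * OO + k * k * (k * D) ∎
    where open ≤-Reasoning

kD[N+k]≤NS : ∀ k′ D S O OO → OO + D ≡ D * D + O →
  let k = suc k′ ; N = k′ + D in
  N * N * (k * D) + 2 * k * N * (k * D) + k * k * O ≤ N * N * S + k * k * OO + k * k * (k * D) →
  k * D * (N + k) ≤ N * S
kD[N+k]≤NS k′ zero S O OO _ _ rewrite *-zeroʳ (suc k′) = z≤n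
kD[N+k]≤NS k′ D@(suc d) S O OO OO+D≡D²+O summed =
  *-cancelˡ-≤ N {{>-nonZero (≤-trans (s≤s z≤n) (m≤n+m (suc d) k′))}} (+-cancelʳ-≤ Z _ _ (begin
    N * (k * D * (N + k)) + Z
      ≡⟨ lhs k′ D O ⟩
    (N * N * (k * D) + 2 * k * N * (k * D) + k * k * O) + k * k * D
      ≤⟨ +-monoˡ-≤ (k * k * D) summed ⟩
    (N * N * S + k * k * OO + k * k * (k * D)) + k * k * D
      ≡⟨ rhs k′ D S OO ⟩
    N * (N * S) + (k * k * (OO + D) + k * k * (k * D))
      ≡⟨ cong (λ t → N * (N * S) + (k * k * t + k * k * (k * D))) OO+D≡D²+O ⟩
    N * (N * S) + Z ∎))
  where
  open ≤-Reasoning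
  k N Z : ℕ
  k = suc k′
  N = k′ + D
  Z = k * k * (D * D + O) + k * k * (k * D)
  lhs : ∀ k′ D O →
    (k′ + D) * (suc k′ * D * ((k′ + D) + suc k′)) + (suc k′ * suc k′ * (D * D + O) + suc k′ * suc k′ * (suc k′ * D))
      ≡ ((k′ + D) * (k′ + D) * (suc k′ * D) + 2 * suc k′ * (k′ + D) * (suc k′ * D) + suc k′ * suc k′ * O)
        + suc k′ * suc k′ * D
  lhs = solve-∀
  rhs : ∀ k′ D S OO →
    ((k′ + D) * (k′ + D) * S + suc k′ * suc k′ * OO + suc k′ * suc k′ * (suc k′ * D)) + suc k′ * suc k′ * D
      ≡ (k′ + D) * ((k′ + D) * S) + (suc k′ * suc k′ * (OO + D) + suc k′ * suc k′ * (suc k′ * D))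
  rhs = solve-∀

expand-deficiency : ∀ k D →
  + (2 * k) -ℤ ((+ (k + D) -ℤ + k) *ℤ (+ (k + D) -ℤ + (5 * k) -ℤ + 1)) ≡ + (2 * k + 4 * (k * D) + D) -ℤ + (D * D)
expand-deficiency k D = begin
  + (2 * k) -ℤ ((+ (k + D) -ℤ + k) *ℤ (+ (k + D) -ℤ + (5 * k) -ℤ + 1))
    ≡⟨ cong₂ (λ a b → a -ℤ ((b -ℤ + k) *ℤ (b -ℤ + (5 * k) -ℤ + 1))) (ℤ.pos-* 2 k) (ℤ.pos-+ k D) ⟩
  + 2 *ℤ + k -ℤ ((+ k +ℤ + D -ℤ + k) *ℤ (+ k +ℤ + D -ℤ + (5 * k) -ℤ + 1))
    ≡⟨ cong (λ c → + 2 *ℤ + k -ℤ ((+ k +ℤ + D -ℤ + k) *ℤ (+ k +ℤ + D -ℤ c -ℤ + 1))) (ℤ.pos-* 5 k) ⟩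
  + 2 *ℤ + k -ℤ ((+ k +ℤ + D -ℤ + k) *ℤ (+ k +ℤ + D -ℤ + 5 *ℤ + k -ℤ + 1))
    ≡⟨ polynomial (+ k) (+ D) ⟩
  + 2 *ℤ + k +ℤ + 4 *ℤ (+ k *ℤ + D) +ℤ + D -ℤ + D *ℤ + D
    ≡⟨ cong₂ _-ℤ_ (sym cast) (sym (ℤ.pos-* D D)) ⟩
  + (2 * k + 4 * (k * D) + D) -ℤ + (D * D) ∎
  where
  open ≡-Reasoning
  polynomial : ∀ (K D : ℤ) → + 2 *ℤ K -ℤ ((K +ℤ D -ℤ K) *ℤ (K +ℤ D -ℤ + 5 *ℤ K -ℤ + 1))
                             ≡ + 2 *ℤ K +ℤ + 4 *ℤ (K *ℤ D) +ℤ D -ℤ D *ℤ D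
  polynomial = ℤ-solve-∀
  cast : + (2 * k + 4 * (k * D) + D) ≡ + 2 *ℤ + k +ℤ + 4 *ℤ (+ k *ℤ + D) +ℤ + D
  cast = trans (ℤ.pos-+ (2 * k + 4 * (k * D)) D) (cong (_+ℤ + D) (trans (ℤ.pos-+ (2 * k) (4 * (k * D)))
           (cong₂ _+ℤ_ (ℤ.pos-* 2 k) (trans (ℤ.pos-* 4 (k * D)) (cong (+ 4 *ℤ_) (ℤ.pos-* k D))))))

+[a+c]-+c≡+a : ∀ a c → + (a + c) -ℤ + c ≡ + a
+[a+c]-+c≡+a a c = trans (cong (_-ℤ + c) (ℤ.pos-+ a c)) (cancel (+ a) (+ c))
  where
  cancel : ∀ (A C : ℤ) → A +ℤ C -ℤ C ≡ A
  cancel = ℤ-solve-∀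

+a-+c≤+b : ∀ {a b c} → a ≤ b + c → + a -ℤ + c ≤ℤ + b
+a-+c≤+b {a} {b} {c} a≤b+c = subst (+ a -ℤ + c ≤ℤ_) (+[a+c]-+c≡+a b c) (ℤ.+-monoˡ-≤ (ℤ.- + c) (ℤ.+≤+ a≤b+c))

totalSize-bound₁ : ∀ k D S O OO {n T} → k + D ≡ n → T ≡ k + S → OO + D ≡ D * D + O →
  (∀ N → N * N * (k * D) + 2 * k * N * (k * D) + k * k * O ≤ N * N * S + k * k * OO + k * k * (k * D)) →
  (n ∸ 1) * (n + 1) * k ≤ (n ∸ 1) * T + k * k * (k ∸ 1)
totalSize-bound₁ zero D S O OO refl refl _ _ rewrite *-zeroʳ ((D ∸ 1) * (D + 1)) = z≤n
totalSize-bound₁ k@(suc k′) D S O OO refl refl OO+D≡D²+O summed = begin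
  N * (suc N + 1) * k
    ≡⟨ expand k′ D ⟩
  N * k + k * D * (N + k) + k * k * k′
    ≤⟨ +-monoˡ-≤ (k * k * k′) (+-monoʳ-≤ (N * k) (kD[N+k]≤NS k′ D S O OO OO+D≡D²+O (summed N))) ⟩
  N * k + N * S + k * k * k′
    ≡⟨ cong (_+ k * k * k′) (sym (*-distribˡ-+ N k S)) ⟩
  N * (k + S) + k * k * k′ ∎
  where
  open ≤-Reasoning
  N : ℕ
  N = k′ + D
  expand : ∀ k′ D → (k′ + D) * (suc (k′ + D) + 1) * suc k′
                  ≡ (k′ + D) * suc k′ + suc k′ * D * ((k′ + D) + suc k′) + suc k′ * suc k′ * k′
  expand = solve-∀

totalSize-bound₂ : ∀ k D S {n T} → k + D ≡ n → T ≡ k + S → 4 * (k * D) + D ≤ 2 * S + D * D →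
  + (2 * k) -ℤ ((+ n -ℤ + k) *ℤ (+ n -ℤ + (5 * k) -ℤ + 1)) ≤ℤ + (2 * T)
totalSize-bound₂ k D S refl refl 4kD+D≤2S+D² = subst (_≤ℤ + (2 * (k + S))) (sym (expand-deficiency k D)) (+a-+c≤+b (begin
  2 * k + 4 * (k * D) + D     ≡⟨ +-assoc (2 * k) (4 * (k * D)) D ⟩
  2 * k + (4 * (k * D) + D)   ≤⟨ +-monoʳ-≤ (2 * k) 4kD+D≤2S+D² ⟩
  2 * k + (2 * S + D * D)     ≡⟨ regroup k S (D * D) ⟩
  2 * (k + S) + D * D         ∎))
  where
  open ≤-Reasoning
  regroup : ∀ k S E → 2 * k + (2 * S + E) ≡ 2 * (k + S) + E
  regroup = solve-∀

blockBounds : ∀ {n} {𝓑 : List (Subset n)} → IsPBD n 𝓑 → ∀ {B₀} → B₀ ∈ 𝓑 →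
  ((n ∸ 1) * (n + 1) * ∣ B₀ ∣ ≤ (n ∸ 1) * totalSize 𝓑 + ∣ B₀ ∣ * ∣ B₀ ∣ * (∣ B₀ ∣ ∸ 1))
  × (+ (2 * ∣ B₀ ∣) -ℤ ((+ n -ℤ + ∣ B₀ ∣) *ℤ (+ n -ℤ + (5 * ∣ B₀ ∣) -ℤ + 1)) ≤ℤ + (2 * totalSize 𝓑))
blockBounds pbd {B₀} B₀∈𝓑 with ∈-∃++ B₀∈𝓑
... | xs , ys , refl = totalSize-bound₁ k D S O OO k+D≡n totalSize≡ ∑ᴸ-away² summed-bound₁
                     , totalSize-bound₂ k D S k+D≡n totalSize≡ 4kD+D≤2S+D²
  where
  open AroundBlock xs B₀ ys pbd
  open RestBounds rest meet away meet≤1 k D ∑ᴸ-meet*away ∑ᴸ-away²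

TwoPoints : ∀ {n} → Subset n → Set
TwoPoints {n} B = Σ (Fin n) λ x → Σ (Fin n) λ y → x ≢ y × x ∈ₛ B × y ∈ₛ B

-- A repeated block would cover one of its pairs of points twice.
blocks-unique : ∀ {n} {𝓑 : List (Subset n)} → (∀ x y → x ≢ y → blocksThrough x y 𝓑 ≤ 1) →
                All TwoPoints 𝓑 → Unique 𝓑
blocks-unique {𝓑 = []} _ [] = []
blocks-unique {𝓑 = B ∷ 𝓑} atMostOnce ((x , y , x≢y , x∈B , y∈B) ∷ twoPoints) =
  All.tabulate B≢ ∷ blocks-unique atMostOnce′ twoPoints
  where
  F : Subset _ → ℕ
  F B = χ B x * χ B y
  F-B : F B ≡ 1
  F-B = cong₂ _*_ (cong 𝟙 (dec-true (x ∈ₛ? B) x∈B)) (cong 𝟙 (dec-true (y ∈ₛ? B) y∈B))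
  ∑F≤0 : ∑ᴸ 𝓑 F ≤ 0
  ∑F≤0 = s≤s⁻¹ (subst (_≤ 1) (trans (blocksThrough≡∑χχ x y (B ∷ 𝓑)) (cong (_+ ∑ᴸ 𝓑 F) F-B))
                              (atMostOnce x y x≢y))
  B≢ : ∀ {B′} → B′ ∈ 𝓑 → B ≢ B′
  B≢ B∈𝓑 refl = <⇒≱ (subst (_≤ ∑ᴸ 𝓑 F) F-B (∈⇒≤∑ᴸ F B∈𝓑)) ∑F≤0
  atMostOnce′ : ∀ x y → x ≢ y → blocksThrough x y 𝓑 ≤ 1
  atMostOnce′ x′ y′ x′≢y′ = begin
    blocksThrough x′ y′ 𝓑                           ≡⟨ blocksThrough≡∑χχ x′ y′ 𝓑 ⟩
    ∑ᴸ 𝓑 (λ B → χ B x′ * χ B y′)                    ≤⟨ m≤n+m _ (χ B x′ * χ B y′) ⟩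
    χ B x′ * χ B y′ + ∑ᴸ 𝓑 (λ B → χ B x′ * χ B y′)
      ≡⟨ sym (blocksThrough≡∑χχ x′ y′ (B ∷ 𝓑)) ⟩
    blocksThrough x′ y′ (B ∷ 𝓑)                     ≤⟨ atMostOnce x′ y′ x′≢y′ ⟩
    1                                               ∎
    where open ≤-Reasoning

does≡true⇒ : ∀ {P : Set} (P? : Dec P) → does P? ≡ true → P
does≡true⇒ (yes p) _ = p

subsetOf : ∀ {n} → List ℕ → Subset n
subsetOf L = tabulate (λ x → does (toℕ x ∈ℕ? L))

module _ {n} {L : List ℕ} {x : Fin n} where

  ∈-subsetOf⁺ : toℕ x ∈ L → x ∈ₛ subsetOf L
  ∈-subsetOf⁺ x∈L = lookup⇒[]= x (subsetOf L) (trans (lookup∘tabulate _ x) (dec-true (toℕ x ∈ℕ? L) x∈L))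

  ∈-subsetOf⁻ : x ∈ₛ subsetOf L → toℕ x ∈ L
  ∈-subsetOf⁻ x∈ = does≡true⇒ (toℕ x ∈ℕ? L) (trans (sym (lookup∘tabulate _ x)) ([]=⇒lookup x∈))

  χ-subsetOf : χ (subsetOf L) x ≡ 𝟙 (does (toℕ x ∈ℕ? L))
  χ-subsetOf = cong 𝟙 (does-⇔ (mk⇔ ∈-subsetOf⁻ ∈-subsetOf⁺) (x ∈ₛ? subsetOf L) (toℕ x ∈ℕ? L))

∑-𝟙-toℕ≡ : ∀ {n a} → a < n → ∑[ x < n ] 𝟙 (does (toℕ x ≟ a)) ≡ 1
∑-𝟙-toℕ≡ {n} {a} a<n = trans (sum-cong-≗ {n} 𝟙≡1*δ) (∑-δ (λ _ → 1) (fromℕ< a<n))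
  where
  toℕ≡⇔ : ∀ {x} → fromℕ< a<n ≡ x ⇔ toℕ x ≡ a
  toℕ≡⇔ = mk⇔ (λ { refl → toℕ-fromℕ< a<n }) (λ { refl → fromℕ<-toℕ _ a<n })
  𝟙≡1*δ : ∀ x → 𝟙 (does (toℕ x ≟ a)) ≡ 1 * δ (fromℕ< a<n) x
  𝟙≡1*δ x = sym (trans (*-identityˡ _) (cong 𝟙 (does-⇔ toℕ≡⇔ (fromℕ< a<n ≟ᶠ x) (toℕ x ≟ a))))

DistinctBelow : ℕ → List ℕ → Set
DistinctBelow n L = Unique L × All (_< n) L

∣subsetOf∣ : ∀ {n} {L : List ℕ} → DistinctBelow n L → ∣ subsetOf {n} L ∣ ≡ length L
∣subsetOf∣ {n} {L} (unique , bounded) =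
  trans (∣B∣≡∑χ (subsetOf {n} L)) (trans (sum-cong-≗ {n} (λ x → χ-subsetOf {n} {L} {x})) (count unique bounded))
  where
  count : ∀ {L} → Unique L → All (_< n) L → ∑[ x < n ] 𝟙 (does (toℕ x ∈ℕ? L)) ≡ length L
  count {[]} _ _ = sum-replicate-zero n
  count {a ∷ L} (a∉L ∷ unique) (a<n ∷ bounded) = begin
    ∑[ x < n ] 𝟙 (does (toℕ x ≟ a) ∨ does (toℕ x ∈ℕ? L))
      ≡⟨ sum-cong-≗ {n} (λ x → 𝟙-∨ _ _ (λ x≡a → dec-false (toℕ x ∈ℕ? L)
           (λ x∈L → All.lookup a∉L x∈L (sym (does≡true⇒ (toℕ x ≟ a) x≡a))))) ⟩
    ∑[ x < n ] (𝟙 (does (toℕ x ≟ a)) + 𝟙 (does (toℕ x ∈ℕ? L)))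
      ≡⟨ ∑-distrib-+ {n} (λ x → 𝟙 (does (toℕ x ≟ a))) (λ x → 𝟙 (does (toℕ x ∈ℕ? L))) ⟩
    ∑[ x < n ] 𝟙 (does (toℕ x ≟ a)) + ∑[ x < n ] 𝟙 (does (toℕ x ∈ℕ? L))
      ≡⟨ cong₂ _+_ (∑-𝟙-toℕ≡ a<n) (count unique bounded) ⟩
    suc (length L) ∎
    where open ≡-Reasoning

rowsBelow : (ℕ → List ℕ) → ℕ → List (ℕ × ℕ)
rowsBelow f zero = []
rowsBelow f (suc t) = map (_, t) (f t) ++ rowsBelow f t

module _ (f : ℕ → List ℕ) where

  ∈-rowsBelow⁻ : ∀ {t a b} → (a , b) ∈ rowsBelow f t → b < t × a ∈ f b
  ∈-rowsBelow⁻ {suc t} ab∈ with ∈-++⁻ (map (_, t) (f t)) ab∈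
  ... | inj₁ ab∈row with ∈-map⁻ (_, t) ab∈row
  ...   | _ , a∈ , refl = ≤-refl , a∈
  ∈-rowsBelow⁻ {suc t} ab∈ | inj₂ ab∈rows = let b<t , a∈ = ∈-rowsBelow⁻ ab∈rows in m<n⇒m<1+n b<t , a∈

  ∈-rowsBelow⁺ : ∀ {t a b} → b < t → a ∈ f b → (a , b) ∈ rowsBelow f t
  ∈-rowsBelow⁺ {suc t} b<1+t a∈ with m<1+n⇒m<n∨m≡n b<1+t
  ... | inj₁ b<t = ∈-++⁺ʳ (map (_, t) (f t)) (∈-rowsBelow⁺ b<t a∈)
  ... | inj₂ refl = ∈-++⁺ˡ (∈-map⁺ (_, t) a∈)

  rowsBelow-unique : ∀ t → (∀ {b} → b < t → Unique (f b)) → Unique (rowsBelow f t)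
  rowsBelow-unique zero _ = []
  rowsBelow-unique (suc t) unique =
    Unique.++⁺ (Unique.map⁺ (cong proj₁) (unique ≤-refl)) (rowsBelow-unique t (unique ∘ m<n⇒m<1+n)) disjoint
    where
    disjoint : ∀ {z} → ¬ (z ∈ map (_, t) (f t) × z ∈ rowsBelow f t)
    disjoint (z∈row , z∈rows) with ∈-map⁻ (_, t) z∈row
    ... | _ , _ , refl = <-irrefl refl (proj₁ (∈-rowsBelow⁻ z∈rows))

  length-rowsBelow : ∀ t → length (rowsBelow f (suc t)) ≡ length (f t) + length (rowsBelow f t)
  length-rowsBelow t = trans (length-++ (map (_, t) (f t))) (cong (_+ length (rowsBelow f t)) (length-map (_, t) (f t)))

length-rowsBelow-upTo : ∀ t → 2 * length (rowsBelow upTo t) + t ≡ t * t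
length-rowsBelow-upTo zero = refl
length-rowsBelow-upTo (suc t) = begin
  2 * length (rowsBelow upTo (suc t)) + suc t    ≡⟨ cong (λ l → 2 * l + suc t) (length-rowsBelow upTo t) ⟩
  2 * (length (upTo t) + L) + suc t              ≡⟨ cong (λ l → 2 * (l + L) + suc t) (length-upTo t) ⟩
  2 * (t + L) + suc t                            ≡⟨ regroup t L ⟩
  (2 * L + t) + (2 * t + 1)                      ≡⟨ cong (_+ (2 * t + 1)) (length-rowsBelow-upTo t) ⟩
  t * t + (2 * t + 1)                            ≡⟨ square-suc t ⟩
  suc t * suc t                                  ∎
  where
  open ≡-Reasoning
  L : ℕ
  L = length (rowsBelow upTo t)
  regroup : ∀ t L → 2 * (t + L) + suc t ≡ (2 * L + t) + (2 * t + 1)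
  regroup = solve-∀
  square-suc : ∀ t → t * t + (2 * t + 1) ≡ suc t * suc t
  square-suc = solve-∀

length-rowsBelow-const : ∀ (f : ℕ → List ℕ) c → (∀ b → length (f b) ≡ c) → ∀ t → length (rowsBelow f t) ≡ t * c
length-rowsBelow-const f c length-f zero = refl
length-rowsBelow-const f c length-f (suc t) =
  trans (length-rowsBelow f t) (cong₂ _+_ (length-f t) (length-rowsBelow-const f c length-f t))

Covers : ℕ → ℕ → List ℕ → Set
Covers u v L = u ∈ L × v ∈ L

covers? : ∀ u v → Decidable (Covers u v)
covers? u v L = u ∈ℕ? L ×-dec v ∈ℕ? L

coverCount : ℕ → ℕ → List (List ℕ) → ℕ
coverCount u v Ls = ∑ᴸ Ls (λ L → 𝟙 (does (covers? u v L)))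

coverCount-comm : ∀ u v Ls → coverCount u v Ls ≡ coverCount v u Ls
coverCount-comm u v Ls = ∑ᴸ-cong Ls (λ L → cong 𝟙 (∧-comm (does (u ∈ℕ? L)) (does (v ∈ℕ? L))))

blocksThrough-subsetOf : ∀ {n} (x y : Fin n) (Ls : List (List ℕ)) →
                         blocksThrough x y (map subsetOf Ls) ≡ coverCount (toℕ x) (toℕ y) Ls
blocksThrough-subsetOf {n} x y Ls = begin
  blocksThrough x y (map subsetOf Ls)                       ≡⟨ blocksThrough≡∑χχ x y (map subsetOf Ls) ⟩
  ∑ᴸ (map subsetOf Ls) (λ B → χ B x * χ B y)                ≡⟨ ∑ᴸ-map subsetOf Ls (λ B → χ B x * χ B y) ⟩
  ∑ᴸ Ls (λ L → χ (subsetOf L) x * χ (subsetOf L) y)         ≡⟨ ∑ᴸ-cong Ls χχ-subsetOf ⟩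
  coverCount (toℕ x) (toℕ y) Ls                             ∎
  where
  open ≡-Reasoning
  χχ-subsetOf : ∀ L → χ (subsetOf L) x * χ (subsetOf L) y ≡ 𝟙 (does (covers? (toℕ x) (toℕ y) L))
  χχ-subsetOf L = trans (cong₂ _*_ (χ-subsetOf {n} {L} {x}) (χ-subsetOf {n} {L} {y}))
                        (sym (𝟙-∧ (does (toℕ x ∈ℕ? L)) (does (toℕ y ∈ℕ? L))))

twoPoints-subsetOf : ∀ {n u v} {L : List ℕ} → u < n → v < n → u ≢ v → Covers u v L → TwoPoints (subsetOf {n} L)
twoPoints-subsetOf u<n v<n u≢v (u∈L , v∈L) =
  fromℕ< u<n , fromℕ< v<n , (λ eq → u≢v (trans (sym (toℕ-fromℕ< u<n)) (trans (cong toℕ eq) (toℕ-fromℕ< v<n))))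
  , ∈-subsetOf⁺ (subst (_∈ _) (sym (toℕ-fromℕ< u<n)) u∈L) , ∈-subsetOf⁺ (subst (_∈ _) (sym (toℕ-fromℕ< v<n)) v∈L)


-- A design attaining the last bound

-- i ⊕ j is (i + j) mod m only for i, j < m: reduce subtracts m at most once.
module AddMod (m : ℕ) where

  reduce : ℕ → ℕ
  reduce s = if does (s <? m) then s else s ∸ m

  _⊕_ : ℕ → ℕ → ℕ
  i ⊕ j = reduce (i + j)

  reduce-< : ∀ {s} → s < m → reduce s ≡ s
  reduce-< {s} s<m rewrite dec-true (s <? m) s<m = refl

  m+reduce : ∀ {s} → m ≤ s → m + reduce s ≡ s
  m+reduce {s} m≤s rewrite dec-false (s <? m) (≤⇒≯ m≤s) = m+[n∸m]≡n m≤s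

  ⊕-comm : ∀ i j → i ⊕ j ≡ j ⊕ i
  ⊕-comm i j = cong reduce (+-comm i j)

  ⊕-< : ∀ {i j} → i < m → j < m → i ⊕ j < m
  ⊕-< {i} {j} i<m j<m with i + j <? m
  ... | yes s<m = subst (_< m) (sym (reduce-< s<m)) s<m
  ... | no s≮m = +-cancelˡ-< m _ _ (subst (_< m + m) (sym (m+reduce (≮⇒≥ s≮m))) (+-mono-< i<m j<m))

  +-no-wrap : ∀ i {j j′} → j′ < m → i + j′ ≢ m + (i + j)
  +-no-wrap i {j} {j′} j′<m eq =
    <⇒≱ j′<m (subst (m ≤_) (sym (+-cancelˡ-≡ i j′ (m + j) (trans eq (x+yz≡y+xz m i j)))) (m≤m+n m j))

  ⊕-cancelˡ : ∀ i {j j′} → j < m → j′ < m → i ⊕ j ≡ i ⊕ j′ → j ≡ j′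
  ⊕-cancelˡ i {j} {j′} j<m j′<m eq with i + j <? m | i + j′ <? m
  ... | yes s<m | yes s′<m = +-cancelˡ-≡ i j j′ (trans (sym (reduce-< s<m)) (trans eq (reduce-< s′<m)))
  ... | no s≮m | no s′≮m = +-cancelˡ-≡ i j j′
        (trans (sym (m+reduce (≮⇒≥ s≮m))) (trans (cong (λ t → m + t) eq) (m+reduce (≮⇒≥ s′≮m))))
  ... | yes s<m | no s′≮m = ⊥-elim (+-no-wrap i j′<m
        (trans (sym (m+reduce (≮⇒≥ s′≮m))) (cong (λ t → m + t) (trans (sym eq) (reduce-< s<m)))))
  ... | no s≮m | yes s′<m = ⊥-elim (+-no-wrap i j<m
        (trans (sym (m+reduce (≮⇒≥ s≮m))) (cong (λ t → m + t) (trans eq (reduce-< s′<m)))))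

  ⊕-solve : ∀ {i u} → i < m → u < m → Σ ℕ λ j → j < m × i ⊕ j ≡ u
  ⊕-solve {i} {u} i<m u<m with i ≤? u
  ... | yes i≤u = u ∸ i , ≤-<-trans (m∸n≤m u i) u<m , trans (cong reduce (m+[n∸m]≡n i≤u)) (reduce-< u<m)
  ... | no i≰u = u + m ∸ i , j<m , +-cancelˡ-≡ m _ _ (trans (cong (λ t → m + reduce t) i+j≡u+m)
                                                              (trans (m+reduce (m≤n+m m u)) (+-comm u m)))
    where
    i+j≡u+m : i + (u + m ∸ i) ≡ u + m
    i+j≡u+m = m+[n∸m]≡n (≤-trans (<⇒≤ i<m) (m≤n+m m u))
    j<m : u + m ∸ i < m
    j<m = +-cancelˡ-< i _ _ (subst (_< i + m) (sym i+j≡u+m) (+-monoˡ-< m (≰⇒> i≰u)))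

ExtremalDesign : ℕ → ℕ → Set
ExtremalDesign n k = Σ (List (Subset n)) λ 𝓑 → IsPBD n 𝓑
  × Σ (Subset n) (λ B → B ∈ 𝓑 × ∣ B ∣ ≡ k)
  × (+ (2 * totalSize 𝓑) ≡ (+ (2 * k)) -ℤ ((+ n -ℤ + k) *ℤ (+ n -ℤ + (5 * k) -ℤ + 1)))

module Construction (m r : ℕ) where

  k n : ℕ
  k = m + r
  n = k + m

  open AddMod m

  data Point : ℕ → Set where
    old : ∀ {u} → u < k → Point u
    new : ∀ {i} → i < m → Point (k + i)

  point : ∀ {u} → u < n → Point u
  point {u} u<n with u <? k
  ... | yes u<k = old u<k
  ... | no u≮k = subst Point k+[u∸k]≡u (new (+-cancelˡ-< k _ _ (subst (_< n) (sym k+[u∸k]≡u) u<n)))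
    where
    k+[u∸k]≡u : k + (u ∸ k) ≡ u
    k+[u∸k]≡u = m+[n∸m]≡n (≮⇒≥ u≮k)

  k≤k+ : ∀ i → k ≤ k + i
  k≤k+ i = m≤m+n k i

  k+<n : ∀ {i} → i < m → k + i < n
  k+<n i<m = +-monoʳ-< k i<m

  <k⇒<n : ∀ {u} → u < k → u < n
  <k⇒<n u<k = <-≤-trans u<k (m≤m+n k m)

  ⊕-<k : ∀ {i j} → i < m → j < m → i ⊕ j < k
  ⊕-<k i<m j<m = <-≤-trans (⊕-< i<m j<m) (m≤m+n m r)

  spokes : ℕ → List ℕ
  spokes i = i ⊕ i ∷ map (λ y → m + y) (upTo r)

  triangle edges : List (ℕ × ℕ)
  triangle = rowsBelow upTo m
  edges = rowsBelow spokes m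

  triple edge : ℕ × ℕ → List ℕ
  triple (i , j) = i ⊕ j ∷ k + i ∷ k + j ∷ []
  edge (x , i) = x ∷ k + i ∷ []

  blocks : List (List ℕ)
  blocks = upTo k ∷ map triple triangle ++ map edge edges

  design : List (Subset n)
  design = map subsetOf blocks

  ∈-triangle⁻ : ∀ {a b} → (a , b) ∈ triangle → a < b × b < m
  ∈-triangle⁻ ab∈ = let b<m , a∈ = ∈-rowsBelow⁻ upTo ab∈ in ∈-upTo⁻ a∈ , b<m

  ∈-triangle⁺ : ∀ {a b} → a < b → b < m → (a , b) ∈ triangle
  ∈-triangle⁺ a<b b<m = ∈-rowsBelow⁺ upTo b<m (∈-upTo⁺ a<b)

  ∈-spokes⁻ : ∀ {x i} → x ∈ spokes i → x ≡ i ⊕ i ⊎ (m ≤ x × x < k)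
  ∈-spokes⁻ (here x≡) = inj₁ x≡
  ∈-spokes⁻ (there x∈) with ∈-map⁻ (λ y → m + y) x∈
  ... | y , y∈ , refl = inj₂ (m≤m+n m y , +-monoʳ-< m (∈-upTo⁻ y∈))

  ∈-spokes⁺ : ∀ {x i} → x ≡ i ⊕ i ⊎ (m ≤ x × x < k) → x ∈ spokes i
  ∈-spokes⁺ (inj₁ x≡) = here x≡
  ∈-spokes⁺ {x} (inj₂ (m≤x , x<k)) = there (subst (_∈ _) (m+[n∸m]≡n m≤x)
    (∈-map⁺ (λ y → m + y) (∈-upTo⁺ (+-cancelˡ-< m _ _ (subst (_< k) (sym (m+[n∸m]≡n m≤x)) x<k)))))

  ∈-edges⁻ : ∀ {x i} → (x , i) ∈ edges → i < m × x < k × (x ≡ i ⊕ i ⊎ m ≤ x)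
  ∈-edges⁻ {x} {i} xi∈ with ∈-rowsBelow⁻ spokes xi∈
  ... | i<m , x∈ with ∈-spokes⁻ {x} {i} x∈
  ...   | inj₁ x≡ = i<m , subst (_< k) (sym x≡) (⊕-<k i<m i<m) , inj₁ x≡
  ...   | inj₂ (m≤x , x<k) = i<m , x<k , inj₂ m≤x

  old∈triple : ∀ {u i j} → u < k → u ∈ triple (i , j) → u ≡ i ⊕ j
  old∈triple u<k (here u≡) = u≡
  old∈triple {i = i} u<k (there (here refl)) = ⊥-elim (<⇒≱ u<k (k≤k+ i))
  old∈triple {j = j} u<k (there (there (here refl))) = ⊥-elim (<⇒≱ u<k (k≤k+ j))

  new∈triple : ∀ {a i j} → i < m → j < m → k + a ∈ triple (i , j) → a ≡ i ⊎ a ≡ j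
  new∈triple {a} i<m j<m (here eq) = ⊥-elim (<⇒≱ (⊕-<k i<m j<m) (subst (k ≤_) eq (k≤k+ a)))
  new∈triple i<m j<m (there (here eq)) = inj₁ (+-cancelˡ-≡ k _ _ eq)
  new∈triple i<m j<m (there (there (here eq))) = inj₂ (+-cancelˡ-≡ k _ _ eq)

  triple-comm : ∀ {u i j} → u ∈ triple (i , j) → u ∈ triple (j , i)
  triple-comm {i = i} {j} (here u≡) = here (trans u≡ (⊕-comm i j))
  triple-comm (there (here u≡)) = there (there (here u≡))
  triple-comm (there (there (here u≡))) = there (here u≡)

  old∈edge : ∀ {u x i} → u < k → u ∈ edge (x , i) → u ≡ x
  old∈edge u<k (here u≡) = u≡
  old∈edge {i = i} u<k (there (here refl)) = ⊥-elim (<⇒≱ u<k (k≤k+ i))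

  new∈edge : ∀ {a x i} → x < k → k + a ∈ edge (x , i) → a ≡ i
  new∈edge {a} x<k (here refl) = ⊥-elim (<⇒≱ x<k (k≤k+ a))
  new∈edge x<k (there (here eq)) = +-cancelˡ-≡ k _ _ eq

  triangle-unique : Unique triangle
  triangle-unique = rowsBelow-unique upTo m (λ {b} _ → Unique.upTo⁺ b)

  triangle-single : ∀ {P : ℕ × ℕ → Set} (P? : Decidable P) {i j} → i < m → j < m → i ≢ j →
    P (i , j) → P (j , i) →
    (∀ {a b} → a < b → b < m → P (a , b) → (a ≡ i × b ≡ j) ⊎ (a ≡ j × b ≡ i)) →
    ∑ᴸ triangle (λ z → 𝟙 (does (P? z))) ≡ 1
  triangle-single {P} P? {i} {j} i<m j<m i≢j Pij Pji classify with <-cmp i j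
  ... | tri< i<j _ _ = ∑ᴸ-𝟙-single P? triangle-unique (∈-triangle⁺ i<j j<m) Pij only
    where
    only : ∀ {z} → z ∈ triangle → P z → z ≡ (i , j)
    only {a , b} ab∈ Pab with ∈-triangle⁻ ab∈
    ... | a<b , b<m with classify a<b b<m Pab
    ...   | inj₁ (refl , refl) = refl
    ...   | inj₂ (refl , refl) = ⊥-elim (<-asym i<j a<b)
  ... | tri≈ _ i≡j _ = ⊥-elim (i≢j i≡j)
  ... | tri> _ _ j<i = ∑ᴸ-𝟙-single P? triangle-unique (∈-triangle⁺ j<i i<m) Pji only
    where
    only : ∀ {z} → z ∈ triangle → P z → z ≡ (j , i)
    only {a , b} ab∈ Pab with ∈-triangle⁻ ab∈
    ... | a<b , b<m with classify a<b b<m Pab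
    ...   | inj₁ (refl , refl) = ⊥-elim (<-asym j<i a<b)
    ...   | inj₂ (refl , refl) = refl

  edges-unique : Unique edges
  edges-unique = rowsBelow-unique spokes m spokes-unique
    where
    spokes-unique : ∀ {i} → i < m → Unique (spokes i)
    spokes-unique {i} i<m = All.tabulate diagonal∉ ∷ Unique.map⁺ (+-cancelˡ-≡ m _ _) (Unique.upTo⁺ r)
      where
      diagonal∉ : ∀ {x} → x ∈ map (λ y → m + y) (upTo r) → i ⊕ i ≢ x
      diagonal∉ x∈ refl with ∈-map⁻ (λ y → m + y) x∈
      ... | y , _ , eq = <⇒≱ (⊕-< i<m i<m) (subst (m ≤_) (sym eq) (m≤m+n m y))

  coverCount-blocks : ∀ u v → coverCount u v blocks ≡
    𝟙 (does (covers? u v (upTo k)))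
      + (∑ᴸ triangle (λ z → 𝟙 (does (covers? u v (triple z)))) + ∑ᴸ edges (λ z → 𝟙 (does (covers? u v (edge z)))))
  coverCount-blocks u v = cong (λ t → 𝟙 (does (covers? u v (upTo k))) + t)
    (trans (∑ᴸ-++ (map triple triangle) (map edge edges) (λ L → 𝟙 (does (covers? u v L))))
           (cong₂ _+_ (∑ᴸ-map triple triangle (λ L → 𝟙 (does (covers? u v L))))
                      (∑ᴸ-map edge edges (λ L → 𝟙 (does (covers? u v L))))))

  new∉upTo : ∀ {u i} → ¬ Covers u (k + i) (upTo k)
  new∉upTo {i = i} (_ , v∈) = <⇒≱ (∈-upTo⁻ v∈) (k≤k+ i)

  count-old-old : ∀ {u v} → u < k → v < k → u ≢ v → coverCount u v blocks ≡ 1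
  count-old-old {u} {v} u<k v<k u≢v = trans (coverCount-blocks u v) (cong₂ _+_ inBlock
    (cong₂ _+_ (∑ᴸ-𝟙-none (λ z → covers? u v (triple z)) noTriple)
               (∑ᴸ-𝟙-none (λ z → covers? u v (edge z)) noEdge)))
    where
    inBlock : 𝟙 (does (covers? u v (upTo k))) ≡ 1
    inBlock = cong 𝟙 (dec-true (covers? u v (upTo k)) (∈-upTo⁺ u<k , ∈-upTo⁺ v<k))
    noTriple : ∀ {z} → z ∈ triangle → ¬ Covers u v (triple z)
    noTriple {i , j} _ (u∈ , v∈) = u≢v (trans (old∈triple u<k u∈) (sym (old∈triple v<k v∈)))
    noEdge : ∀ {z} → z ∈ edges → ¬ Covers u v (edge z)
    noEdge {x , i} _ (u∈ , v∈) = u≢v (trans (old∈edge u<k u∈) (sym (old∈edge v<k v∈)))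

  count-new-new : ∀ {i₁ i₂} → i₁ < m → i₂ < m → i₁ ≢ i₂ → coverCount (k + i₁) (k + i₂) blocks ≡ 1
  count-new-new {i₁} {i₂} i₁<m i₂<m i₁≢i₂ = trans (coverCount-blocks (k + i₁) (k + i₂)) (cong₂ _+_
    (cong 𝟙 (dec-false (covers? (k + i₁) (k + i₂) (upTo k)) new∉upTo))
    (cong₂ _+_ (triangle-single (λ z → covers? (k + i₁) (k + i₂) (triple z)) i₁<m i₂<m i₁≢i₂
                  (there (here refl) , there (there (here refl)))
                  (there (there (here refl)) , there (here refl)) classify)
               (∑ᴸ-𝟙-none (λ z → covers? (k + i₁) (k + i₂) (edge z)) noEdge)))
    where
    classify : ∀ {a b} → a < b → b < m → Covers (k + i₁) (k + i₂) (triple (a , b)) →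
               (a ≡ i₁ × b ≡ i₂) ⊎ (a ≡ i₂ × b ≡ i₁)
    classify a<b b<m (u∈ , v∈) with new∈triple (<-trans a<b b<m) b<m u∈ | new∈triple (<-trans a<b b<m) b<m v∈
    ... | inj₁ refl | inj₁ refl = ⊥-elim (i₁≢i₂ refl)
    ... | inj₁ refl | inj₂ refl = inj₁ (refl , refl)
    ... | inj₂ refl | inj₁ refl = inj₂ (refl , refl)
    ... | inj₂ refl | inj₂ refl = ⊥-elim (i₁≢i₂ refl)
    noEdge : ∀ {z} → z ∈ edges → ¬ Covers (k + i₁) (k + i₂) (edge z)
    noEdge {x , i} xi∈ (u∈ , v∈) = let _ , x<k , _ = ∈-edges⁻ xi∈ in
      i₁≢i₂ (trans (new∈edge x<k u∈) (sym (new∈edge x<k v∈)))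

  -- Whether {u, k + i₀} is one of the blocks of size 2.
  Joined : ℕ → ℕ → Set
  Joined u i₀ = u ≡ i₀ ⊕ i₀ ⊎ m ≤ u

  count-joined : ∀ {u i₀} → u < k → i₀ < m → Joined u i₀ → coverCount u (k + i₀) blocks ≡ 1
  count-joined {u} {i₀} u<k i₀<m joined = trans (coverCount-blocks u (k + i₀)) (cong₂ _+_
    (cong 𝟙 (dec-false (covers? u (k + i₀) (upTo k)) new∉upTo))
    (cong₂ _+_ (∑ᴸ-𝟙-none (λ z → covers? u (k + i₀) (triple z)) noTriple)
               (∑ᴸ-𝟙-single (λ z → covers? u (k + i₀) (edge z)) edges-unique
                 (∈-rowsBelow⁺ spokes i₀<m (∈-spokes⁺ {u} {i₀} (Sum.map₂ (_, u<k) joined)))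
                 (here refl , there (here refl)) only)))
    where
    noTriple : ∀ {z} → z ∈ triangle → ¬ Covers u (k + i₀) (triple z)
    noTriple {a , b} ab∈ (u∈ , v∈) = excluded joined (new∈triple a<m b<m v∈)
      where
      a<b : a < b
      a<b = proj₁ (∈-triangle⁻ ab∈)
      b<m : b < m
      b<m = proj₂ (∈-triangle⁻ ab∈)
      a<m : a < m
      a<m = <-trans a<b b<m
      u≡a⊕b : u ≡ a ⊕ b
      u≡a⊕b = old∈triple u<k u∈
      excluded : Joined u i₀ → i₀ ≡ a ⊎ i₀ ≡ b → ⊥
      excluded (inj₂ m≤u) _ = <⇒≱ (subst (_< m) (sym u≡a⊕b) (⊕-< a<m b<m)) m≤u
      excluded (inj₁ u≡i₀⊕i₀) (inj₁ i₀≡a) = <-irrefl (sym (⊕-cancelˡ a b<m a<m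
        (trans (sym u≡a⊕b) (trans u≡i₀⊕i₀ (cong (λ t → t ⊕ t) i₀≡a))))) a<b
      excluded (inj₁ u≡i₀⊕i₀) (inj₂ i₀≡b) = <-irrefl (⊕-cancelˡ b a<m b<m
        (trans (⊕-comm b a) (trans (sym u≡a⊕b) (trans u≡i₀⊕i₀ (cong (λ t → t ⊕ t) i₀≡b))))) a<b
    only : ∀ {z} → z ∈ edges → Covers u (k + i₀) (edge z) → z ≡ (u , i₀)
    only {x , i} xi∈ (u∈ , v∈) = let _ , x<k , _ = ∈-edges⁻ xi∈ in
      cong₂ _,_ (sym (old∈edge u<k u∈)) (sym (new∈edge x<k v∈))

  count-unjoined : ∀ {u i₀} → u < k → i₀ < m → ¬ Joined u i₀ → coverCount u (k + i₀) blocks ≡ 1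
  count-unjoined {u} {i₀} u<k i₀<m unjoined = trans (coverCount-blocks u (k + i₀)) (cong₂ _+_
    (cong 𝟙 (dec-false (covers? u (k + i₀) (upTo k)) new∉upTo))
    (cong₂ _+_ (triangle-single (λ z → covers? u (k + i₀) (triple z)) i₀<m j<m i₀≢j
                  (here (sym i₀⊕j≡u) , there (here refl))
                  (triple-comm (here (sym i₀⊕j≡u)) , there (there (here refl))) classify)
               (∑ᴸ-𝟙-none (λ z → covers? u (k + i₀) (edge z)) noEdge)))
    where
    u<m : u < m
    u<m = ≰⇒> (unjoined ∘ inj₂)
    j : ℕ
    j = proj₁ (⊕-solve i₀<m u<m)
    j<m : j < m
    j<m = proj₁ (proj₂ (⊕-solve i₀<m u<m))
    i₀⊕j≡u : i₀ ⊕ j ≡ u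
    i₀⊕j≡u = proj₂ (proj₂ (⊕-solve i₀<m u<m))
    i₀≢j : i₀ ≢ j
    i₀≢j i₀≡j = unjoined (inj₁ (trans (sym i₀⊕j≡u) (cong (i₀ ⊕_) (sym i₀≡j))))
    classify : ∀ {a b} → a < b → b < m → Covers u (k + i₀) (triple (a , b)) →
               (a ≡ i₀ × b ≡ j) ⊎ (a ≡ j × b ≡ i₀)
    classify {a} {b} a<b b<m (u∈ , v∈) with old∈triple u<k u∈ | new∈triple (<-trans a<b b<m) b<m v∈
    ... | u≡ | inj₁ refl = inj₁ (refl , ⊕-cancelˡ a b<m j<m (trans (sym u≡) (sym i₀⊕j≡u)))
    ... | u≡ | inj₂ refl =
      inj₂ (⊕-cancelˡ b (<-trans a<b b<m) j<m (trans (⊕-comm b a) (trans (sym u≡) (sym i₀⊕j≡u))) , refl)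
    noEdge : ∀ {z} → z ∈ edges → ¬ Covers u (k + i₀) (edge z)
    noEdge {x , i} xi∈ (u∈ , v∈) with ∈-edges⁻ xi∈
    ... | _ , x<k , joinedᵢ with old∈edge u<k u∈ | new∈edge x<k v∈
    ...   | refl | refl = unjoined joinedᵢ

  count-old-new : ∀ {u i₀} → u < k → i₀ < m → coverCount u (k + i₀) blocks ≡ 1
  count-old-new {u} {i₀} u<k i₀<m with (u ≟ i₀ ⊕ i₀) ⊎-dec (m ≤? u)
  ... | yes joined = count-joined u<k i₀<m joined
  ... | no unjoined = count-unjoined u<k i₀<m unjoined

  coverCount-≡1 : ∀ {u v} → u < n → v < n → u ≢ v → coverCount u v blocks ≡ 1
  coverCount-≡1 u<n v<n u≢v with point u<n | point v<n
  ... | old u<k | old v<k = count-old-old u<k v<k u≢v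
  ... | old u<k | new i<m = count-old-new u<k i<m
  ... | new i<m | old v<k = trans (coverCount-comm _ _ blocks) (count-old-new v<k i<m)
  ... | new i<m | new j<m = count-new-new i<m j<m (λ i≡j → u≢v (cong (λ t → k + t) i≡j))

  design-pairs-once : ∀ (x y : Fin n) → x ≢ y → blocksThrough x y design ≡ 1
  design-pairs-once x y x≢y =
    trans (blocksThrough-subsetOf x y blocks) (coverCount-≡1 (toℕ<n x) (toℕ<n y) (x≢y ∘ toℕ-injective))

  upTo-k-distinct : DistinctBelow n (upTo k)
  upTo-k-distinct = Unique.upTo⁺ k , All.tabulate (<k⇒<n ∘ ∈-upTo⁻)

  triple-distinct : ∀ {z} → z ∈ triangle → DistinctBelow n (triple z)
  triple-distinct {i , j} z∈ =
    ((⊕≢ i ∷ ⊕≢ j ∷ []) ∷ ((λ eq → <-irrefl (+-cancelˡ-≡ k i j eq) i<j) ∷ []) ∷ [] ∷ [])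
    , <k⇒<n (⊕-<k i<m j<m) ∷ k+<n i<m ∷ k+<n j<m ∷ []
    where
    i<j : i < j
    i<j = proj₁ (∈-triangle⁻ z∈)
    j<m : j < m
    j<m = proj₂ (∈-triangle⁻ z∈)
    i<m : i < m
    i<m = <-trans i<j j<m
    ⊕≢ : ∀ a → i ⊕ j ≢ k + a
    ⊕≢ a eq = <⇒≱ (⊕-<k i<m j<m) (subst (k ≤_) (sym eq) (k≤k+ a))

  edge-distinct : ∀ {z} → z ∈ edges → DistinctBelow n (edge z)
  edge-distinct {x , i} z∈ =
    ((λ eq → <⇒≱ x<k (subst (k ≤_) (sym eq) (k≤k+ i))) ∷ []) ∷ [] ∷ []
    , <k⇒<n x<k ∷ k+<n i<m ∷ []
    where
    i<m : i < m
    i<m = proj₁ (∈-edges⁻ z∈)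
    x<k : x < k
    x<k = proj₁ (proj₂ (∈-edges⁻ z∈))

  totalSize-design : totalSize design ≡ k + (3 * length triangle + 2 * length edges)
  totalSize-design = begin
    totalSize design
      ≡⟨ ∑ᴸ-map (subsetOf {n}) blocks ∣_∣ ⟩
    ∣ subsetOf {n} (upTo k) ∣ + ∑ᴸ (map triple triangle ++ map edge edges) (λ L → ∣ subsetOf {n} L ∣)
      ≡⟨ cong₂ _+_ (trans (∣subsetOf∣ upTo-k-distinct) (length-upTo k))
                   (∑ᴸ-++ (map triple triangle) (map edge edges) _) ⟩
    k + (∑ᴸ (map triple triangle) (λ L → ∣ subsetOf {n} L ∣) + ∑ᴸ (map edge edges) (λ L → ∣ subsetOf {n} L ∣))
      ≡⟨ cong (λ t → k + t) (cong₂ _+_ (∑ᴸ-map triple triangle _) (∑ᴸ-map edge edges _)) ⟩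
    k + (∑ᴸ triangle (λ z → ∣ subsetOf {n} (triple z) ∣) + ∑ᴸ edges (λ z → ∣ subsetOf {n} (edge z) ∣))
      ≡⟨ cong (λ t → k + t) (cong₂ _+_ (∑ᴸ-cong-All (All.tabulate (∣subsetOf∣ ∘ triple-distinct)))
                                       (∑ᴸ-cong-All (All.tabulate (∣subsetOf∣ ∘ edge-distinct)))) ⟩
    k + (∑ᴸ triangle (λ _ → 3) + ∑ᴸ edges (λ _ → 2))
      ≡⟨ cong (λ t → k + t) (cong₂ _+_ (∑ᴸ-const triangle 3) (∑ᴸ-const edges 2)) ⟩
    k + (3 * length triangle + 2 * length edges) ∎
    where open ≡-Reasoning

  twice-totalSize : 2 * totalSize design + m * m ≡ 2 * k + 4 * (k * m) + m
  twice-totalSize = +-cancelʳ-≡ (3 * m) _ _ (begin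
    2 * totalSize design + m * m + 3 * m
      ≡⟨ cong (λ t → 2 * t + m * m + 3 * m) totalSize-design ⟩
    2 * (k + (3 * T + 2 * E)) + m * m + 3 * m
      ≡⟨ regroup k T E m ⟩
    2 * k + 3 * (2 * T + m) + 4 * E + m * m
      ≡⟨ cong₂ (λ s e → 2 * k + 3 * s + 4 * e + m * m) (length-rowsBelow-upTo m) length-edges ⟩
    2 * k + 3 * (m * m) + 4 * (m * suc r) + m * m
      ≡⟨ expand m r ⟩
    2 * k + 4 * (k * m) + m + 3 * m ∎)
    where
    open ≡-Reasoning
    T E : ℕ
    T = length triangle
    E = length edges
    length-edges : E ≡ m * suc r
    length-edges = length-rowsBelow-const spokes (suc r)
      (λ i → cong suc (trans (length-map (λ y → m + y) (upTo r)) (length-upTo r))) m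
    regroup : ∀ k T E m → 2 * (k + (3 * T + 2 * E)) + m * m + 3 * m ≡ 2 * k + 3 * (2 * T + m) + 4 * E + m * m
    regroup = solve-∀
    expand : ∀ m r → 2 * (m + r) + 3 * (m * m) + 4 * (m * suc r) + m * m
                   ≡ 2 * (m + r) + 4 * ((m + r) * m) + m + 3 * m
    expand = solve-∀

  twice-totalSizeℤ : + (2 * totalSize design) ≡ (+ (2 * k)) -ℤ ((+ n -ℤ + k) *ℤ (+ n -ℤ + (5 * k) -ℤ + 1))
  twice-totalSizeℤ = sym (trans (expand-deficiency k m) (trans (cong (λ t → + t -ℤ + (m * m)) (sym twice-totalSize))
                                                              (+[a+c]-+c≡+a (2 * totalSize design) (m * m))))

  design-unique : 2 ≤ k → Unique design
  design-unique 2≤k =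
    blocks-unique {𝓑 = design} (λ x y x≢y → ≤-reflexive (design-pairs-once x y x≢y)) (All.map⁺ two-in-blocks)
    where
    0<k : 0 < k
    0<k = <-trans (s≤s z≤n) 2≤k
    two-in-block : TwoPoints (subsetOf {n} (upTo k))
    two-in-block = twoPoints-subsetOf {L = upTo k} (<k⇒<n 0<k) (<k⇒<n 2≤k) (λ ()) (∈-upTo⁺ 0<k , ∈-upTo⁺ 2≤k)
    two-in-triple : ∀ {z} → z ∈ triangle → TwoPoints (subsetOf {n} (triple z))
    two-in-triple {i , j} z∈ = twoPoints-subsetOf {L = triple (i , j)} (k+<n (<-trans i<j j<m)) (k+<n j<m)
      (λ eq → <-irrefl (+-cancelˡ-≡ k i j eq) i<j) (there (here refl) , there (there (here refl)))
      where
      i<j : i < j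
      i<j = proj₁ (∈-triangle⁻ z∈)
      j<m : j < m
      j<m = proj₂ (∈-triangle⁻ z∈)
    two-in-edge : ∀ {z} → z ∈ edges → TwoPoints (subsetOf {n} (edge z))
    two-in-edge {x , i} z∈ = twoPoints-subsetOf {L = edge (x , i)} (<k⇒<n x<k) (k+<n i<m)
      (λ eq → <⇒≱ x<k (subst (k ≤_) (sym eq) (k≤k+ i))) (here refl , there (here refl))
      where
      i<m : i < m
      i<m = proj₁ (∈-edges⁻ z∈)
      x<k : x < k
      x<k = proj₁ (proj₂ (∈-edges⁻ z∈))
    two-in-blocks : All (TwoPoints ∘ subsetOf {n}) blocks
    two-in-blocks =
      two-in-block ∷ All.++⁺ (All.map⁺ (All.tabulate two-in-triple)) (All.map⁺ (All.tabulate two-in-edge))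

  extremal : Unique design → ExtremalDesign n k
  extremal unique = design , (unique , design-pairs-once)
    , (subsetOf (upTo k) , here refl , trans (∣subsetOf∣ upTo-k-distinct) (length-upTo k)) , twice-totalSizeℤ

extremalDesign : ∀ n k → 2 ≤ n → n ≤ 2 * k → k ≤ n → ExtremalDesign n k
extremalDesign n zero 2≤n n≤0 _ = ⊥-elim (<⇒≱ 2≤n (≤-trans n≤0 z≤n))
extremalDesign zero (suc zero) () _ _
extremalDesign (suc zero) (suc zero) (s≤s ()) _ _
-- For k = 1 the block {0} has one point, so uniqueness of {{0}, {0, 1}} is checked directly.
extremalDesign (suc (suc zero)) (suc zero) _ _ _ = Construction.extremal 1 0 (((λ ()) ∷ []) ∷ [] ∷ [])
extremalDesign (suc (suc (suc _))) (suc zero) _ (s≤s (s≤s ())) _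
extremalDesign n k@(suc (suc _)) _ n≤2k k≤n = subst₂ ExtremalDesign m+r+m≡n m+r≡k
  (Construction.extremal m r (Construction.design-unique m r (subst (2 ≤_) (sym m+r≡k) (s≤s (s≤s z≤n)))))
  where
  m r : ℕ
  m = n ∸ k
  r = k ∸ m
  m+r≡k : m + r ≡ k
  m+r≡k = m+[n∸m]≡n (m≤n+o⇒m∸n≤o n k (subst (n ≤_) (cong (λ t → k + t) (+-identityʳ k)) n≤2k))
  m+r+m≡n : m + r + m ≡ n
  m+r+m≡n = trans (cong (_+ m) m+r≡k) (m+[n∸m]≡n k≤n)

mainTheorem5 :
  (∀ (n : ℕ) (𝓑 : List (Subset n)) → 2 ≤ n → IsPBD n 𝓑 →
    (n * (n ∸ 1) ≤ (maxBlockSize 𝓑 ∸ 1) * totalSize 𝓑)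
    × (∀ (k : ℕ) → Σ (Subset n) (λ B → B ∈ 𝓑 × ∣ B ∣ ≡ k) →
        ((n ∸ 1) * (n + 1) * k ≤ (n ∸ 1) * totalSize 𝓑 + k * k * (k ∸ 1))
        × ((+ (2 * k)) -ℤ ((+ n -ℤ + k) *ℤ (+ n -ℤ + (5 * k) -ℤ + 1)) ≤ℤ + (2 * totalSize 𝓑))))
  × (∀ (n k : ℕ) → 2 ≤ n → n ≤ 2 * k → k ≤ n →
      Σ (List (Subset n)) (λ 𝓑 → IsPBD n 𝓑
        × Σ (Subset n) (λ B → B ∈ 𝓑 × ∣ B ∣ ≡ k)
        × (+ (2 * totalSize 𝓑) ≡ (+ (2 * k)) -ℤ ((+ n -ℤ + k) *ℤ (+ n -ℤ + (5 * k) -ℤ + 1)))))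
mainTheorem5 =
    (λ n 𝓑 _ pbd → fisherBound pbd , λ { k (B₀ , B₀∈𝓑 , refl) → blockBounds pbd B₀∈𝓑 })
  , extremalDesign
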